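{- Let $T$ be a caterpillar tree with $n\ge 3$ vertices and backbone $v_1,v_2,\dots,v_m$. Consider Rosa's arrangement $\pi$: place $v_1$ at one end of the arrangement and the leaves adjacent to $v_1$ consecutively at the other end; then, for $k=2,\dots,m$, place $v_k$ in the free position immediately next to the block of leaves of $v_{k-1}$, and place the leaves adjacent to $v_k$ (other than already placed vertices) consecutively in the free positions immediately next to $v_{k-1}$ (so the two ends of the remaining free interval are filled alternately). Then: (i) $\pi$ is a planar arrangement of $T$ of maximum cost among all planar arrangements of $T$; (ii) $D^{\mathrm{pl}}_{\max}(T)=\binom{n}{2}$; (iii) the maximum of $D^{\mathrm{pl}}_{\max}(T')$ over all free trees $T'$ with $n$ vertices is attained by every caterpillar tree with $n$ vertices (in particular by $T$); (iv) $v_1$ and $v_m$ belong to $V^*=\{v : D^{\mathrm{pl}}_{\max}(T)=D^{\mathrm{pr}}_{\max}(T^v)\}$.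
   Context: A caterpillar tree is a tree such that removing all its leaves yields a path (or a single vertex); this path $v_1,\dots,v_m$ is its backbone, and its endpoints are $v_1,v_m$. A linear arrangement of a graph $G=(V,E)$ with $n=|V|$ is a bijection $\pi:V\to\{1,\dots,n\}$; the cost of $\pi$ is $\sum_{uv\in E}|\pi(u)-\pi(v)|$. Two edges $st,uv$ with $\pi(s)<\pi(t)$, $\pi(u)<\pi(v)$, $\pi(s)<\pi(u)$ cross if $\pi(s)<\pi(u)<\pi(t)<\pi(v)$; an arrangement is planar if no two edges cross. $D^{\mathrm{pl}}_{\max}(T)$ is the maximum cost over planar arrangements of $T$. For a vertex $v$, $T^v$ is $T$ rooted at $v$; an arrangement of $T^v$ is projective if it is planar and no edge $xy$ satisfies $\min(\pi(x),\pi(y))<\pi(v)<\max(\pi(x),\pi(y))$, and $D^{\mathrm{pr}}_{\max}(T^v)$ is the maximum cost over projective arrangements of $T^v$. -}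

module Defs where

open import Data.Nat using (ℕ; zero; suc; _+_; _∸_; _≤_; _<_; ∣_-_∣)
open import Data.Nat.Properties using () renaming (_≟_ to _≟ℕ_)
open import Data.Fin using (Fin; toℕ) renaming (zero to fzero; suc to fsuc)
open import Data.Fin.Properties using () renaming (_≟_ to _≟F_)
open import Data.Fin.Permutation using (Permutation′; _⟨$⟩ʳ_)
open import Data.List using (List; length; filter; map; allFin)
open import Data.Nat.ListAction using (sum)
open import Data.List.Relation.Unary.AllPairs using (AllPairs)
open import Data.List.Membership.Propositional using (_∈_)
import Data.List.Membership.DecPropositional as DecMem
open import Data.Product using (Σ; ∃; _×_; _,_; proj₁; proj₂)
open import Data.Product.Properties using (≡-dec)
open import Data.Sum using (_⊎_)
open import Relation.Nullary using (¬_; Dec)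
open import Relation.Nullary.Decidable using (_×-dec_; _⊎-dec_)
open import Relation.Binary.PropositionalEquality using (_≡_; _≢_)
open import Function using (_∘_; Injective)

Edge : ℕ → Set
Edge n = Fin n × Fin n

EdgeList : ℕ → Set
EdgeList n = List (Edge n)

module _ {n : ℕ} where

  _≟E_ : (e f : Edge n) → Dec (e ≡ f)
  _≟E_ = ≡-dec _≟F_ _≟F_

  open DecMem _≟E_ using (_∈?_)

  Adj : EdgeList n → Fin n → Fin n → Set
  Adj E u v = ((u , v) ∈ E) ⊎ ((v , u) ∈ E)

  Adj? : (E : EdgeList n) (u v : Fin n) → Dec (Adj E u v)
  Adj? E u v = ((u , v) ∈? E) ⊎-dec ((v , u) ∈? E)

  Incident : Fin n → Edge n → Set
  Incident v e = (v ≡ proj₁ e) ⊎ (v ≡ proj₂ e)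

  Incident? : (v : Fin n) (e : Edge n) → Dec (Incident v e)
  Incident? v e = (v ≟F proj₁ e) ⊎-dec (v ≟F proj₂ e)

  deg : EdgeList n → Fin n → ℕ
  deg E v = length (filter (Incident? v) E)

  Leaf : EdgeList n → Fin n → Set
  Leaf E v = deg E v ≡ 1

  Leaf? : (E : EdgeList n) (v : Fin n) → Dec (Leaf E v)
  Leaf? E v = deg E v ≟ℕ 1

  SameEdge : Edge n → Edge n → Set
  SameEdge (a , b) (c , d) = (a ≡ c × b ≡ d) ⊎ (a ≡ d × b ≡ c)

  Simple : EdgeList n → Set
  Simple E = (∀ e → e ∈ E → proj₁ e ≢ proj₂ e)
           × AllPairs (λ e f → ¬ SameEdge e f) E

  data Reach (E : EdgeList n) : Fin n → Fin n → Set where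
    here : ∀ {u} → Reach E u u
    step : ∀ {u v w} → Adj E u v → Reach E v w → Reach E u w

  Connected : EdgeList n → Set
  Connected E = ∀ u v → Reach E u v

IsTree : (n : ℕ) → EdgeList n → Set
IsTree n E = Simple E × Connected E × length E ≡ n ∸ 1

-- Caterpillars and backbones.
-- bb : Fin (suc m) → Fin n lists the backbone v₁ … v_{m+1}: the non-leaf
-- vertices are exactly the (distinct) bb k, and the subgraph induced by
-- them is the path bb 0 – bb 1 – … – bb m.

IsBackbone : (n : ℕ) → EdgeList n → (m : ℕ) → (Fin (suc m) → Fin n) → Set
IsBackbone n E m bb =
    Injective _≡_ _≡_ bb
  × (∀ k → ¬ Leaf E (bb k))
  × (∀ v → ¬ Leaf E v → ∃ λ k → bb k ≡ v)
  × (∀ i j → (Adj E (bb i) (bb j) → ∣ toℕ i - toℕ j ∣ ≡ 1)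
           × (∣ toℕ i - toℕ j ∣ ≡ 1 → Adj E (bb i) (bb j)))

IsCaterpillar : (n : ℕ) → EdgeList n → Set
IsCaterpillar n E = IsTree n E × ∃ λ m → Σ (Fin (suc m) → Fin n) (IsBackbone n E m)

-- Linear arrangements: bijections V → positions (positions 0 … n-1).

Arrangement : ℕ → Set
Arrangement n = Permutation′ n

pos : ∀ {n} → Arrangement n → Fin n → ℕ
pos π v = toℕ (π ⟨$⟩ʳ v)

cost : ∀ {n} → EdgeList n → Arrangement n → ℕ
cost E π = sum (map (λ e → ∣ pos π (proj₁ e) - pos π (proj₂ e) ∣) E)

lpos rpos : ∀ {n} → Arrangement n → Edge n → ℕ
lpos π (a , b) with pos π a Data.Nat.≤? pos π b
... | Relation.Nullary.yes _ = pos π a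
... | Relation.Nullary.no  _ = pos π b
rpos π (a , b) with pos π a Data.Nat.≤? pos π b
... | Relation.Nullary.yes _ = pos π b
... | Relation.Nullary.no  _ = pos π a

Cross : ∀ {n} → Arrangement n → Edge n → Edge n → Set
Cross π e f = lpos π e < lpos π f × lpos π f < rpos π e × rpos π e < rpos π f

Planar : ∀ {n} → EdgeList n → Arrangement n → Set
Planar E π = ∀ e f → e ∈ E → f ∈ E → ¬ Cross π e f

Projective : ∀ {n} → EdgeList n → Fin n → Arrangement n → Set
Projective E r π = Planar E π × (∀ e → e ∈ E → ¬ (lpos π e < pos π r × pos π r < rpos π e))

IsDplMax : (n : ℕ) → EdgeList n → ℕ → Set
IsDplMax n E d = (∃ λ π → Planar E π × cost E π ≡ d)
               × (∀ π → Planar E π → cost E π ≤ d)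

IsDprMax : (n : ℕ) → EdgeList n → Fin n → ℕ → Set
IsDprMax n E r d = (∃ λ π → Projective E r π × cost E π ≡ d)
                 × (∀ π → Projective E r π → cost E π ≤ d)

InVStar : (n : ℕ) → EdgeList n → Fin n → Set
InVStar n E v = ∃ λ d → IsDplMax n E d × IsDprMax n E v d

-- State: free interval [a , b] of positions and the side at which the next
-- backbone vertex goes.  For a backbone vertex with L leaves:
--   side left : vertex at a, its leaves in [b+1-L , b]; next (a+1 , b-L , right)
--   side right: vertex at b, its leaves in [a , a+L-1]; next (a+L , b-1 , left)
-- (the leaves of v_k thus go next to v_{k-1}, and v_k goes next to the
-- leaf block of v_{k-1}).  The result for v_k is
-- (position of v_k , first position of its leaf block , block size).

data Side : Set where
  left right : Side

rosaStep : ℕ → ℕ → Side → ℕ → (ℕ × ℕ × ℕ) × (ℕ × ℕ × Side)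
rosaStep a b left  L = (a , suc b ∸ L , L) , (suc a , b ∸ L , right)
rosaStep a b right L = (b , a , L)         , (a + L , b ∸ 1 , left)

rosa : ℕ → ℕ → Side → (m : ℕ) → (Fin m → ℕ) → Fin m → ℕ × ℕ × ℕ
rosa a b s (suc m) L fzero    = proj₁ (rosaStep a b s (L fzero))
rosa a b s (suc m) L (fsuc k) with proj₂ (rosaStep a b s (L fzero))
... | (a' , b' , s') = rosa a' b' s' m (L ∘ fsuc) k

leafCount : ∀ {n} → EdgeList n → Fin n → ℕ
leafCount {n} E w = length (filter (λ u → Leaf? E u ×-dec Adj? E u w) (allFin n))

RosaFrom : (n : ℕ) → EdgeList n → (m : ℕ) → (Fin (suc m) → Fin n) → (Fin n → ℕ) → Set
RosaFrom n E m bb f = ∀ k →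
  let r = rosa 0 (n ∸ 1) left (suc m) (leafCount E ∘ bb) k in
    f (bb k) ≡ proj₁ r
  × (∀ u → Leaf E u → Adj E u (bb k) →
       proj₁ (proj₂ r) ≤ f u × f u < proj₁ (proj₂ r) + proj₂ (proj₂ r))

-- v₁ may be placed at either end (the second case is the mirror image)
IsRosa : (n : ℕ) → EdgeList n → (m : ℕ) → (Fin (suc m) → Fin n) → Arrangement n → Set
IsRosa n E m bb π = RosaFrom n E m bb (pos π)
                  ⊎ RosaFrom n E m bb (λ v → n ∸ 1 ∸ pos π v)

-- In a planar arrangement the edges are distinct, pairwise non-crossing intervals of
-- [0 , n - 1]; such a laminar family has at most n - j members longer than j, and summing over the
-- thresholds j bounds the cost by C(n,2). In Rosa's arrangement every edge at backbone step k spans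
-- everything placed after step k, so two edges are nested or share an endpoint (planarity) and have
-- different lengths; n - 1 distinct positive lengths sum to at least C(n,2). The root v₁ sits at
-- position 0, so the arrangement is projective for v₁; reversing the backbone gives the claim for vₘ.
module Submission where

open import Defs
open import Data.Fin using (Fin; zero; suc; fromℕ; toℕ)
import Data.Fin as F
import Data.Fin.Properties as F
open import Data.Fin.Properties using (toℕ-injective; toℕ<n) renaming (_≟_ to _F≟_)
open import Data.Fin.Permutation using (permutation; _⟨$⟩ʳ_; _⟨$⟩ˡ_; inverseˡ)

open import Data.Nat
open import Data.Nat.Properties
open import Data.Nat.Induction using (<-rec)
open import Algebra.Properties.CommutativeSemigroup +-commutativeSemigroup using (interchange)
open import Data.List using (List; []; _∷_; _++_; length; filter; map; [_]; applyUpTo; allFin)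
open import Data.Nat.ListAction using (sum)
open import Data.Nat.Combinatorics using (_C_; nC1≡n; nCk+nC[k+1]≡[n+1]C[k+1])
open import Data.List.Relation.Unary.All as All using (All; []; _∷_)
import Data.List.Relation.Unary.All.Properties as All
open import Data.List.Relation.Unary.Any using (here; there)
open import Data.List.Membership.Propositional using (_∈_; lose)
open import Data.List.Membership.Propositional.Properties using (∈-filter⁻; ∈-filter⁺; ∈-applyUpTo⁺; ∈-map⁻; ∈-allFin; ∈-++⁻; ∈-++⁺ˡ; ∈-++⁺ʳ)
open import Data.List.Relation.Binary.Subset.Propositional using (_⊆_)
open import Data.List.Relation.Unary.Unique.Propositional using (Unique)
open import Data.List.Relation.Unary.AllPairs as AllPairs using (AllPairs; []; _∷_)
import Data.List.Relation.Unary.AllPairs.Properties as AllPairs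
import Data.List.Relation.Unary.Unique.Propositional.Properties as Unique
open import Data.List.Properties using (length-filter; filter-notAll; map-id; length-applyUpTo; length-map; length-++; length-tabulate; filter-accept; filter-reject)
import Data.List.Extrema ≤-totalOrder as Extrema
open import Data.Product using (_×_; _,_; proj₁; proj₂; ∃)
open import Data.Product.Properties using (≡-dec)
open import Data.Sum using (_⊎_; inj₁; inj₂)
open import Data.Empty using (⊥; ⊥-elim)
open import Relation.Nullary using (¬_; Dec; yes; no; ¬?)
open import Relation.Nullary.Decidable using (_×-dec_)
open import Level using (0ℓ)
open import Function using (_∘_; case_of_)
open import Relation.Unary using (Pred; Decidable)
open import Relation.Unary.Properties using (∁?)
open import Relation.Binary.Definitions using (DecidableEquality; tri<; tri≈; tri>)
open import Relation.Binary.PropositionalEquality using (_≡_; _≢_; refl; sym; trans; cong; cong₂; subst; subst₂; module ≡-Reasoning)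

module _ {A : Set} {P : Pred A 0ℓ} (P? : Decidable P) where

  length-filter-∁ : ∀ xs → length xs ≡ length (filter P? xs) + length (filter (∁? P?) xs)
  length-filter-∁ [] = refl
  length-filter-∁ (x ∷ xs) with P? x
  ... | yes _ = cong suc (length-filter-∁ xs)
  ... | no  _ = trans (cong suc (length-filter-∁ xs)) (sym (+-suc _ _))

AllPairs-map∈ : ∀ {A : Set} {R S : A → A → Set} {xs} → AllPairs R xs →
                (∀ {x y} → x ∈ xs → y ∈ xs → R x y → S x y) → AllPairs S xs
AllPairs-map∈ []       _ = []
AllPairs-map∈ (Rx ∷ R!) R⇒S =
  All.tabulate (λ y∈ → R⇒S (here refl) (there y∈) (All.lookup Rx y∈)) ∷ AllPairs-map∈ R! (λ x∈ y∈ → R⇒S (there x∈) (there y∈))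

module _ {A : Set} (_≟_ : DecidableEquality A) where

  Unique-⊆⇒length≤ : ∀ {xs ys} → Unique xs → xs ⊆ ys → length xs ≤ length ys
  Unique-⊆⇒length≤ {[]} _ _ = z≤n
  Unique-⊆⇒length≤ {x ∷ xs} {ys} (x∉xs ∷ xs!) xs⊆ys = begin-strict
    length xs                 ≤⟨ Unique-⊆⇒length≤ xs! xs⊆ys-x ⟩
    length (filter ≢x? ys)    <⟨ filter-notAll ≢x? ys (lose (xs⊆ys (here refl)) λ x≢x → x≢x refl) ⟩
    length ys                 ∎
    where
    open ≤-Reasoning
    ≢x? = λ y → ¬? (y ≟ x)
    xs⊆ys-x : xs ⊆ filter ≢x? ys
    xs⊆ys-x y∈xs = ∈-filter⁺ ≢x? (xs⊆ys (there y∈xs)) λ { refl → All.lookup x∉xs y∈xs refl }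

  Unique⇒length≤suc-remove : ∀ x {xs} → Unique xs → length xs ≤ suc (length (filter (λ y → ¬? (y ≟ x)) xs))
  Unique⇒length≤suc-remove x {xs} xs! = begin
    length xs                                               ≡⟨ length-filter-∁ (_≟ x) xs ⟩
    length (filter (_≟ x) xs) + length (filter (λ y → ¬? (y ≟ x)) xs)
      ≤⟨ +-monoˡ-≤ _ (Unique-⊆⇒length≤ (Unique.filter⁺ (_≟ x) xs!) ⊆[x]) ⟩
    suc (length (filter (λ y → ¬? (y ≟ x)) xs))             ∎
    where
    open ≤-Reasoning
    ⊆[x] : filter (_≟ x) xs ⊆ [ x ]
    ⊆[x] y∈ = here (proj₂ (∈-filter⁻ (_≟ x) {xs = xs} y∈))

-- Laminar families of intervals

Interval : Set
Interval = ℕ × ℕ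

_≟I_ : DecidableEquality Interval
_≟I_ = ≡-dec _≟_ _≟_

width : Interval → ℕ
width (l , r) = r ∸ l

Crossing : Interval → Interval → Set
Crossing (a , b) (c , d) = a < c × c < b × b < d

NonCrossing : List Interval → Set
NonCrossing S = ∀ {x y} → x ∈ S → y ∈ S → ¬ Crossing x y

NonCrossing-⊆ : ∀ {S T} → S ⊆ T → NonCrossing T → NonCrossing S
NonCrossing-⊆ S⊆T nc x∈ y∈ = nc (S⊆T x∈) (S⊆T y∈)

nested⇒¬Crossing : ∀ {l₁ r₁ l₂ r₂} → l₁ ≤ l₂ → r₂ ≤ r₁ → ¬ Crossing (l₁ , r₁) (l₂ , r₂) × ¬ Crossing (l₂ , r₂) (l₁ , r₁)
nested⇒¬Crossing l₁≤l₂ r₂≤r₁ = (λ (_ , _ , r₁<r₂) → <⇒≱ r₁<r₂ r₂≤r₁) , (λ (l₂<l₁ , _ , _) → <⇒≱ l₂<l₁ l₁≤l₂)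

shared-endpoint⇒¬Crossing : ∀ {l₁ r₁ l₂ r₂ p} → l₁ ≡ p ⊎ r₁ ≡ p → l₂ ≡ p ⊎ r₂ ≡ p → ¬ Crossing (l₁ , r₁) (l₂ , r₂)
shared-endpoint⇒¬Crossing (inj₁ refl) (inj₁ refl) (l₁<l₂ , _ , _)         = <-irrefl refl l₁<l₂
shared-endpoint⇒¬Crossing (inj₁ refl) (inj₂ refl) (l₁<l₂ , l₂<r₁ , r₁<r₂) = <-irrefl refl (<-trans l₁<l₂ (<-trans l₂<r₁ r₁<r₂))
shared-endpoint⇒¬Crossing (inj₂ refl) (inj₁ refl) (_ , l₂<r₁ , _)         = <-irrefl refl l₂<r₁
shared-endpoint⇒¬Crossing (inj₂ refl) (inj₂ refl) (_ , _ , r₁<r₂)         = <-irrefl refl r₁<r₂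

WideIn : ℕ → ℕ → ℕ → Interval → Set
WideIn L lo d (l , r) = lo ≤ l × l + L ≤ r × r ≤ lo + d

WideIn⇒≤ : ∀ {L lo d x} → WideIn L lo d x → L ≤ d
WideIn⇒≤ {L} {lo} {d} (lo≤l , l+L≤r , r≤lo+d) =
  +-cancelˡ-≤ lo L d (≤-trans (+-monoˡ-≤ L lo≤l) (≤-trans l+L≤r r≤lo+d))

split-count-arith : ∀ {L d₁ d₂} → 2 ≤ L → L ≤ d₁ → 1 ≤ d₂ →
                    suc ((suc d₁ ∸ L) + (suc d₂ ∸ L)) ≤ suc (d₁ + d₂) ∸ L
split-count-arith {L} {d₁} {suc d₂} 2≤L L≤d₁ _ = begin
  suc ((suc d₁ ∸ L) + (suc (suc d₂) ∸ L)) ≤⟨ s≤s (+-monoʳ-≤ (suc d₁ ∸ L) (∸-monoʳ-≤ (suc (suc d₂)) 2≤L)) ⟩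
  suc ((suc d₁ ∸ L) + d₂)                ≡⟨ sym (+-suc (suc d₁ ∸ L) d₂) ⟩
  (suc d₁ ∸ L) + suc d₂                  ≡⟨ sym (+-∸-comm (suc d₂) (m≤n⇒m≤1+n L≤d₁)) ⟩
  suc (d₁ + suc d₂) ∸ L                  ∎
  where open ≤-Reasoning

-- Distinct non-crossing intervals form a laminar family. Apart from [lo , lo + d] itself, either no interval
-- starts at lo, or the longest one [lo , p] that does splits the others into those inside [lo , p] and [p , lo + d].
module LaminarCount (L : ℕ) (2≤L : 2 ≤ L) where

  CountBound : ℕ → Set
  CountBound d = ∀ lo S → Unique S → NonCrossing S → All (WideIn L lo d) S → length S ≤ suc d ∸ L

  module _ {d} (rec : ∀ {d'} → d' < d → CountBound d') {lo : ℕ} {S : List Interval}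
           (S! : Unique S) (nc : NonCrossing S) (wide : All (WideIn L lo d) S) where

    count-shift : (∀ {x} → x ∈ S → lo < proj₁ x) → ∀ {d'} → d ≡ suc d' → length S ≤ d ∸ L
    count-shift lo<S {d'} refl = rec ≤-refl (suc lo) S S! nc (All.tabulate shift)
      where
      shift : ∀ {x} → x ∈ S → WideIn L (suc lo) d' x
      shift {l , r} x∈ with All.lookup wide x∈
      ... | _ , l+L≤r , r≤ = lo<S x∈ , l+L≤r , subst (r ≤_) (+-suc lo d') r≤

    count-split : ∀ {d₁} → (lo , lo + d₁) ∈ S → d₁ < d → (∀ {r} → (lo , r) ∈ S → r ≤ lo + d₁) →
                  suc (length S) ≤ suc d ∸ L
    count-split {d₁} p∈ d₁<d maximal = begin
      suc (length S)                                  ≡⟨ cong suc (length-filter-∁ ≤p? S) ⟩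
      suc (length (filter ≤p? S) + length (filter >p? S))
        ≤⟨ s≤s (+-mono-≤ (rec d₁<d lo _ (Unique.filter⁺ ≤p? S!) (NonCrossing-⊆ below⊆ nc) (All.tabulate below))
                         (rec d₂<d p _ (Unique.filter⁺ >p? S!) (NonCrossing-⊆ above⊆ nc) (All.tabulate above))) ⟩
      suc ((suc d₁ ∸ L) + (suc d₂ ∸ L))              ≤⟨ split-count-arith 2≤L L≤d₁ (m<n⇒0<n∸m d₁<d) ⟩
      suc (d₁ + d₂) ∸ L                               ≡⟨ cong (λ z → suc z ∸ L) (m+[n∸m]≡n (<⇒≤ d₁<d)) ⟩
      suc d ∸ L                                       ∎
      where
      open ≤-Reasoning
      p = lo + d₁
      d₂ = d ∸ d₁
      hi≡p+d₂ : lo + d ≡ p + d₂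
      hi≡p+d₂ = trans (cong (lo +_) (sym (m+[n∸m]≡n (<⇒≤ d₁<d)))) (sym (+-assoc lo d₁ d₂))
      L≤d₁ : L ≤ d₁
      L≤d₁ = +-cancelˡ-≤ lo L d₁ (proj₁ (proj₂ (All.lookup wide p∈)))
      d₂<d : d₂ < d
      d₂<d = ∸-monoʳ-< (<-≤-trans (s≤s z≤n) (≤-trans 2≤L L≤d₁)) (<⇒≤ d₁<d)
      ≤p? = λ (x : Interval) → proj₂ x ≤? p
      >p? = ∁? ≤p?
      below⊆ : filter ≤p? S ⊆ S
      below⊆ x∈ = proj₁ (∈-filter⁻ ≤p? x∈)
      above⊆ : filter >p? S ⊆ S
      above⊆ x∈ = proj₁ (∈-filter⁻ >p? x∈)
      below : ∀ {x} → x ∈ filter ≤p? S → WideIn L lo d₁ x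
      below x∈ with ∈-filter⁻ ≤p? x∈
      ... | x∈S , r≤p with All.lookup wide x∈S
      ...   | lo≤l , l+L≤r , _ = lo≤l , l+L≤r , r≤p
      above : ∀ {x} → x ∈ filter >p? S → WideIn L p d₂ x
      above {l , r} x∈ with ∈-filter⁻ >p? x∈
      ... | x∈S , r≰p with All.lookup wide x∈S
      ...   | lo≤l , l+L≤r , r≤hi = p≤l , l+L≤r , subst (r ≤_) hi≡p+d₂ r≤hi
        where
        p<r = ≰⇒> r≰p
        -- an interval starting strictly between lo and p and ending after p would cross (lo , p)
        p≤l : p ≤ l
        p≤l with p ≤? l | l ≟ lo
        ... | yes p≤l | _        = p≤l
        ... | no  _   | yes refl = ⊥-elim (r≰p (maximal x∈S))
        ... | no  p≰l | no  l≢lo = ⊥-elim (nc p∈ x∈S (≤∧≢⇒< lo≤l (l≢lo ∘ sym) , ≰⇒> p≰l , p<r))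

    count-proper : (∀ {x} → x ∈ S → x ≢ (lo , lo + d)) → L ≤ d → suc (length S) ≤ suc d ∸ L
    count-proper proper L≤d = count-cases (Extrema.argmax-sel proj₂ (lo , lo) S₀)
      where
      atLo? = λ (x : Interval) → proj₁ x ≟ lo
      S₀ = filter atLo? S
      q = Extrema.argmax proj₂ (lo , lo) S₀
      maximal : ∀ {r} → (lo , r) ∈ S → r ≤ proj₂ q
      maximal r∈ = All.lookup (Extrema.f[xs]≤f[argmax] (lo , lo) S₀) (∈-filter⁺ atLo? r∈ refl)
      count-at : ∀ {x} → x ∈ S → proj₁ x ≡ lo → (∀ {r} → (lo , r) ∈ S → r ≤ proj₂ x) → suc (length S) ≤ suc d ∸ L
      count-at {l , p} x∈ refl maximal′ with All.lookup wide x∈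
      ... | _ , lo+L≤p , p≤hi with m≤n⇒∃[o]m+o≡n (≤-trans (m≤m+n l L) lo+L≤p)
      ...   | d₁ , refl = count-split x∈ (+-cancelˡ-< l d₁ d (≤∧≢⇒< p≤hi (proper x∈ ∘ cong (l ,_)))) maximal′
      count-cases : q ≡ (lo , lo) ⊎ q ∈ S₀ → suc (length S) ≤ suc d ∸ L
      count-cases (inj₂ q∈S₀) = let q∈S , q-at-lo = ∈-filter⁻ atLo? {xs = S} q∈S₀ in count-at q∈S q-at-lo maximal
      count-cases (inj₁ q≡) = begin
        suc (length S) ≤⟨ s≤s (count-shift lo<S (sym (m+[n∸m]≡n (≤-trans (≤-trans (s≤s z≤n) 2≤L) L≤d)))) ⟩
        suc (d ∸ L)    ≡⟨ sym (+-∸-assoc 1 L≤d) ⟩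
        suc d ∸ L      ∎
        where
        open ≤-Reasoning
        -- the only candidate (lo , r) with r ≤ lo would have width 0 < L
        lo<S : ∀ {x} → x ∈ S → lo < proj₁ x
        lo<S {l , r} x∈ with All.lookup wide x∈ | l ≟ lo
        ... | lo≤l , _ , _ | no l≢lo = ≤∧≢⇒< lo≤l (l≢lo ∘ sym)
        ... | _ , lo+L≤r , _ | yes refl =
          ⊥-elim (<-irrefl refl (<-≤-trans (m<m+n l (≤-trans (s≤s z≤n) 2≤L))
                   (≤-trans lo+L≤r (≤-trans (maximal x∈) (≤-reflexive (cong proj₂ q≡))))))

  count-bound : ∀ d → CountBound d
  count-bound = <-rec CountBound bound-step
    where
    bound-step : ∀ d → (∀ {d'} → d' < d → CountBound d') → CountBound d
    bound-step d rec lo [] _ _ _ = z≤n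
    bound-step d rec lo S@(_ ∷ _) S! nc wide@(w₀ ∷ _) =
      ≤-trans (Unique⇒length≤suc-remove _≟I_ (lo , lo + d) S!)
              (count-proper rec (Unique.filter⁺ proper? S!) (NonCrossing-⊆ S'⊆S nc) (All.tabulate (All.lookup wide ∘ S'⊆S))
                            (proj₂ ∘ ∈-filter⁻ proper? {xs = S}) (WideIn⇒≤ w₀))
      where
      proper? = λ (x : Interval) → ¬? (x ≟I (lo , lo + d))
      S'⊆S : filter proper? S ⊆ S
      S'⊆S = proj₁ ∘ ∈-filter⁻ proper? {xs = S}

-- Threshold sums

sum< : ℕ → (ℕ → ℕ) → ℕ
sum< zero    g = 0
sum< (suc M) g = sum< M g + g M

sum<-cong : ∀ M {g h} → (∀ j → j < M → g j ≡ h j) → sum< M g ≡ sum< M h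
sum<-cong zero    g≡h = refl
sum<-cong (suc M) g≡h = cong₂ _+_ (sum<-cong M (λ j j<M → g≡h j (m<n⇒m<1+n j<M))) (g≡h M ≤-refl)

sum<-mono-≤ : ∀ M {g h} → (∀ j → j < M → g j ≤ h j) → sum< M g ≤ sum< M h
sum<-mono-≤ zero    g≤h = z≤n
sum<-mono-≤ (suc M) g≤h = +-mono-≤ (sum<-mono-≤ M (λ j j<M → g≤h j (m<n⇒m<1+n j<M))) (g≤h M ≤-refl)

sum<-monoˡ-≤ : ∀ g {K M} → K ≤ M → sum< K g ≤ sum< M g
sum<-monoˡ-≤ g {M = zero}  z≤n = z≤n
sum<-monoˡ-≤ g {M = suc M} K≤M with m≤n⇒m<n∨m≡n K≤M
... | inj₁ K<1+M = ≤-trans (sum<-monoˡ-≤ g (≤-pred K<1+M)) (m≤m+n _ _)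
... | inj₂ refl  = ≤-refl

sum<-+ : ∀ M g h → sum< M (λ j → g j + h j) ≡ sum< M g + sum< M h
sum<-+ zero    g h = refl
sum<-+ (suc M) g h = trans (cong (_+ (g M + h M)) (sum<-+ M g h)) (interchange (sum< M g) (sum< M h) (g M) (h M))

sum<-const : ∀ M c → sum< M (λ _ → c) ≡ M * c
sum<-const zero    c = refl
sum<-const (suc M) c = trans (cong (_+ c) (sum<-const M c)) (+-comm (M * c) c)

module _ {A : Set} (f : A → ℕ) where

  sum<-count-below : ∀ M x → sum< M (λ j → length (filter (λ y → j <? f y) [ x ])) ≡ M ⊓ f x
  sum<-count-below zero    x = refl
  sum<-count-below (suc M) x with M <? f x
  ... | yes M<fx = begin
    sum< M (λ j → length (filter (λ y → j <? f y) [ x ])) + length (filter (λ y → M <? f y) [ x ])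
      ≡⟨ cong₂ _+_ (sum<-count-below M x) (cong length (filter-accept (λ y → M <? f y) M<fx)) ⟩
    M ⊓ f x + 1 ≡⟨ cong (_+ 1) (m≤n⇒m⊓n≡m (<⇒≤ M<fx)) ⟩
    M + 1       ≡⟨ +-comm M 1 ⟩
    suc M       ≡⟨ sym (m≤n⇒m⊓n≡m M<fx) ⟩
    suc M ⊓ f x ∎
    where open ≡-Reasoning
  ... | no  M≮fx = begin
    sum< M (λ j → length (filter (λ y → j <? f y) [ x ])) + length (filter (λ y → M <? f y) [ x ])
      ≡⟨ cong₂ _+_ (sum<-count-below M x) (cong length (filter-reject (λ y → M <? f y) M≮fx)) ⟩
    M ⊓ f x + 0 ≡⟨ +-identityʳ _ ⟩
    M ⊓ f x     ≡⟨ m≥n⇒m⊓n≡n fx≤M ⟩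
    f x         ≡⟨ sym (m≥n⇒m⊓n≡n (m≤n⇒m≤1+n fx≤M)) ⟩
    suc M ⊓ f x ∎
    where
    open ≡-Reasoning
    fx≤M = ≮⇒≥ M≮fx

length-filter-∷ : ∀ {A : Set} {P : Pred A 0ℓ} (P? : Decidable P) x xs →
                  length (filter P? (x ∷ xs)) ≡ length (filter P? [ x ]) + length (filter P? xs)
length-filter-∷ P? x xs with P? x
... | yes _ = refl
... | no  _ = refl

-- "Layer cake": a value f x ≤ M is the number of thresholds j < M that it exceeds.
layer-cake : ∀ {A : Set} (f : A → ℕ) M xs → All (λ x → f x ≤ M) xs →
             sum (map f xs) ≡ sum< M (λ j → length (filter (λ x → j <? f x) xs))
layer-cake f M [] [] = sym (trans (sum<-const M 0) (*-zeroʳ M))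
layer-cake f M (x ∷ xs) (fx≤M ∷ xs≤M) = begin
  f x + sum (map f xs)
    ≡⟨ cong₂ _+_ (sym (trans (sum<-count-below f M x) (m≥n⇒m⊓n≡n fx≤M))) (layer-cake f M xs xs≤M) ⟩
  sum< M (λ j → length (filter (λ y → j <? f y) [ x ])) + sum< M (λ j → length (filter (λ y → j <? f y) xs))
    ≡⟨ sym (sum<-+ M _ _) ⟩
  sum< M (λ j → length (filter (λ y → j <? f y) [ x ]) + length (filter (λ y → j <? f y) xs))
    ≡⟨ sum<-cong M (λ j _ → sym (length-filter-∷ (λ y → j <? f y) x xs)) ⟩
  sum< M (λ j → length (filter (λ y → j <? f y) (x ∷ xs))) ∎
  where open ≡-Reasoning

sum<-triangle : ∀ N → sum< N (λ j → N ∸ j) ≡ suc N C 2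
sum<-triangle zero    = refl
sum<-triangle (suc N) = begin
  sum< N (λ j → suc N ∸ j) + (suc N ∸ N)
    ≡⟨ cong₂ _+_ (sum<-cong N (λ j j<N → +-∸-assoc 1 (<⇒≤ j<N))) (m+n∸n≡m 1 N) ⟩
  sum< N (λ j → 1 + (N ∸ j)) + 1                ≡⟨ cong (_+ 1) (sum<-+ N (λ _ → 1) (λ j → N ∸ j)) ⟩
  sum< N (λ _ → 1) + sum< N (λ j → N ∸ j) + 1   ≡⟨ cong₂ (λ a b → a + b + 1) (trans (sum<-const N 1) (*-identityʳ N)) (sum<-triangle N) ⟩
  N + suc N C 2 + 1                             ≡⟨ trans (+-comm (N + suc N C 2) 1) (cong (_+ suc N C 2) (sym (nC1≡n (suc N)))) ⟩
  suc N C 1 + suc N C 2                         ≡⟨ nCk+nC[k+1]≡[n+1]C[k+1] (suc N) 1 ⟩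
  suc (suc N) C 2                               ∎
  where open ≡-Reasoning

laminar-width-sum≤ : ∀ N S → Unique S → NonCrossing S → All (WideIn 1 0 N) S → length S ≤ N →
                     sum (map width S) ≤ suc N C 2
laminar-width-sum≤ N S S! nc wide S≤N = begin
  sum (map width S)                                      ≡⟨ layer-cake width N S (All.map width≤N wide) ⟩
  sum< N (λ j → length (filter (λ x → j <? width x) S)) ≤⟨ sum<-mono-≤ N wider-count ⟩
  sum< N (λ j → N ∸ j)                                   ≡⟨ sum<-triangle N ⟩
  suc N C 2                                              ∎
  where
  open ≤-Reasoning
  width≤N : ∀ {x} → WideIn 1 0 N x → width x ≤ N
  width≤N {l , r} (_ , _ , r≤N) = ≤-trans (m∸n≤m r l) r≤N
  wider-count : ∀ j → j < N → length (filter (λ x → j <? width x) S) ≤ N ∸ j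
  -- the laminar count needs width at least 2, so width 1 is bounded by the size of S
  wider-count zero    _ = ≤-trans (length-filter _ S) S≤N
  wider-count (suc j) _ =
    LaminarCount.count-bound (2 + j) (s≤s (s≤s z≤n)) N 0 (filter wider? S)
      (Unique.filter⁺ wider? S!) (NonCrossing-⊆ (proj₁ ∘ ∈-filter⁻ wider? {xs = S}) nc) (All.tabulate wider⇒wide)
    where
    wider? = λ (x : Interval) → suc j <? width x
    wider⇒wide : ∀ {x} → x ∈ filter wider? S → WideIn (2 + j) 0 N x
    wider⇒wide {l , r} x∈ with ∈-filter⁻ wider? {xs = S} x∈
    ... | x∈S , 2+j≤r-l with All.lookup wide x∈S
    ...   | _ , l+1≤r , r≤N =
      z≤n , ≤-trans (+-monoʳ-≤ l 2+j≤r-l) (≤-reflexive (m+[n∸m]≡n (≤-trans (m≤m+n l 1) l+1≤r))) , r≤N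

distinct-positive-sum≥ : ∀ xs → Unique xs → All (1 ≤_) xs → suc (length xs) C 2 ≤ sum xs
distinct-positive-sum≥ xs xs! xs≥1 = begin
  suc (length xs) C 2                                      ≡⟨ sym (sum<-triangle (length xs)) ⟩
  sum< (length xs) (λ j → length xs ∸ j)                   ≤⟨ sum<-mono-≤ (length xs) (λ j _ → larger-count j) ⟩
  sum< (length xs) (λ j → length (filter (j <?_) xs))      ≤⟨ sum<-monoˡ-≤ _ (sum-≥-length xs xs≥1) ⟩
  sum< (sum xs) (λ j → length (filter (j <?_) xs))         ≡⟨ sym (layer-cake (λ x → x) (sum xs) xs (≤-sum xs)) ⟩
  sum (map (λ x → x) xs)                                   ≡⟨ cong sum (map-id xs) ⟩
  sum xs                                                   ∎
  where
  open ≤-Reasoning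
  sum-≥-length : ∀ ys → All (1 ≤_) ys → length ys ≤ sum ys
  sum-≥-length []       []         = z≤n
  sum-≥-length (y ∷ ys) (1≤y ∷ ys≥1) = +-mono-≤ 1≤y (sum-≥-length ys ys≥1)
  ≤-sum : ∀ ys → All (_≤ sum ys) ys
  ≤-sum []       = []
  ≤-sum (y ∷ ys) = m≤m+n y (sum ys) ∷ All.map (λ z≤ → ≤-trans z≤ (m≤n+m (sum ys) y)) (≤-sum ys)
  -- the values ≤ j are distinct and lie in {1, …, j}
  larger-count : ∀ j → length xs ∸ j ≤ length (filter (j <?_) xs)
  larger-count j = begin
    length xs ∸ j                                  ≡⟨ cong (_∸ j) (length-filter-∁ (j <?_) xs) ⟩
    length (filter (j <?_) xs) + length small ∸ j   ≤⟨ ∸-monoʳ-≤ (length (filter (j <?_) xs) + length small) small≤j ⟩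
    length (filter (j <?_) xs) + length small ∸ length small ≡⟨ m+n∸n≡m _ (length small) ⟩
    length (filter (j <?_) xs)                     ∎
    where
    small = filter (∁? (j <?_)) xs
    small⊆ : small ⊆ applyUpTo suc j
    small⊆ x∈ with ∈-filter⁻ (∁? (j <?_)) {xs = xs} x∈
    ... | x∈xs , x≯j with All.lookup xs≥1 x∈xs
    ...   | s≤s z≤n = ∈-applyUpTo⁺ suc (≮⇒≥ x≯j)
    small≤j : length small ≤ j
    small≤j = ≤-trans (Unique-⊆⇒length≤ _≟_ (Unique.filter⁺ (∁? (j <?_)) xs!) small⊆) (≤-reflexive (length-applyUpTo suc j))

-- Arrangements as interval families

∣m-n∣≡m⊔n∸m⊓n : ∀ m n → ∣ m - n ∣ ≡ m ⊔ n ∸ m ⊓ n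
∣m-n∣≡m⊔n∸m⊓n m n with ≤-total m n
... | inj₁ m≤n rewrite m≤n⇒m⊔n≡n m≤n | m≤n⇒m⊓n≡m m≤n = m≤n⇒∣m-n∣≡n∸m m≤n
... | inj₂ n≤m rewrite m≥n⇒m⊔n≡m n≤m | m≥n⇒m⊓n≡n n≤m = trans (∣-∣-comm m n) (m≤n⇒∣m-n∣≡n∸m n≤m)

⊓-⊔-injective : ∀ {x y z w} → x ⊓ y ≡ z ⊓ w → x ⊔ y ≡ z ⊔ w → (x ≡ z × y ≡ w) ⊎ (x ≡ w × y ≡ z)
⊓-⊔-injective {x} {y} {z} {w} ⊓≡ ⊔≡ with ≤-total x y | ≤-total z w
... | inj₁ x≤y | inj₁ z≤w rewrite m≤n⇒m⊓n≡m x≤y | m≤n⇒m⊔n≡n x≤y | m≤n⇒m⊓n≡m z≤w | m≤n⇒m⊔n≡n z≤w = inj₁ (⊓≡ , ⊔≡)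
... | inj₁ x≤y | inj₂ w≤z rewrite m≤n⇒m⊓n≡m x≤y | m≤n⇒m⊔n≡n x≤y | m≥n⇒m⊓n≡n w≤z | m≥n⇒m⊔n≡m w≤z = inj₂ (⊓≡ , ⊔≡)
... | inj₂ y≤x | inj₁ z≤w rewrite m≥n⇒m⊓n≡n y≤x | m≥n⇒m⊔n≡m y≤x | m≤n⇒m⊓n≡m z≤w | m≤n⇒m⊔n≡n z≤w = inj₂ (⊔≡ , ⊓≡)
... | inj₂ y≤x | inj₂ w≤z rewrite m≥n⇒m⊓n≡n y≤x | m≥n⇒m⊔n≡m y≤x | m≥n⇒m⊓n≡n w≤z | m≥n⇒m⊔n≡m w≤z = inj₁ (⊔≡ , ⊓≡)

endpoint : ∀ p o → p ⊓ o ≡ p ⊎ p ⊔ o ≡ p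
endpoint p o with ≤-total p o
... | inj₁ p≤o = inj₁ (m≤n⇒m⊓n≡m p≤o)
... | inj₂ o≤p = inj₂ (m≥n⇒m⊔n≡m o≤p)

module _ {n : ℕ} where

  interval : (Fin n → ℕ) → Edge n → Interval
  interval f e = (f (proj₁ e) ⊓ f (proj₂ e) , f (proj₁ e) ⊔ f (proj₂ e))

  PlanarAt : EdgeList n → (Fin n → ℕ) → Set
  PlanarAt E f = ∀ {e g} → e ∈ E → g ∈ E → ¬ Crossing (interval f e) (interval f g)

  costAt : EdgeList n → (Fin n → ℕ) → ℕ
  costAt E f = sum (map (λ e → ∣ f (proj₁ e) - f (proj₂ e) ∣) E)

  costAt≡sum-width : ∀ E f → costAt E f ≡ sum (map width (map (interval f) E))
  costAt≡sum-width []      f = refl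
  costAt≡sum-width (e ∷ E) f = cong₂ _+_ (∣m-n∣≡m⊔n∸m⊓n (f (proj₁ e)) (f (proj₂ e))) (costAt≡sum-width E f)

  module _ {f : Fin n → ℕ} (f-injective : ∀ {u v} → f u ≡ f v → u ≡ v) where

    interval-injective : ∀ {e g} → interval f e ≡ interval f g → SameEdge e g
    interval-injective {a , b} {c , d} eq with ⊓-⊔-injective (cong proj₁ eq) (cong proj₂ eq)
    ... | inj₁ (fa≡fc , fb≡fd) = inj₁ (f-injective fa≡fc , f-injective fb≡fd)
    ... | inj₂ (fa≡fd , fb≡fc) = inj₂ (f-injective fa≡fd , f-injective fb≡fc)

    interval-nonempty : ∀ {a b} → a ≢ b → f a ⊓ f b < f a ⊔ f b
    interval-nonempty {a} {b} a≢b with ≤-total (f a) (f b)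
    ... | inj₁ fa≤fb rewrite m≤n⇒m⊓n≡m fa≤fb | m≤n⇒m⊔n≡n fa≤fb = ≤∧≢⇒< fa≤fb (a≢b ∘ f-injective)
    ... | inj₂ fb≤fa rewrite m≥n⇒m⊓n≡n fb≤fa | m≥n⇒m⊔n≡m fb≤fa = ≤∧≢⇒< fb≤fa (a≢b ∘ sym ∘ f-injective)

  pos-injective : ∀ (π : Arrangement n) {u v} → pos π u ≡ pos π v → u ≡ v
  pos-injective π {u} {v} eq =
    trans (sym (inverseˡ π)) (trans (cong (π ⟨$⟩ˡ_) (toℕ-injective eq)) (inverseˡ π))

  pos<n : ∀ (π : Arrangement n) v → pos π v < n
  pos<n π v = toℕ<n (π ⟨$⟩ʳ v)

  lpos≡ : ∀ (π : Arrangement n) e → lpos π e ≡ proj₁ (interval (pos π) e)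
  lpos≡ π e with pos π (proj₁ e) ≤? pos π (proj₂ e)
  ... | yes ≤ = sym (m≤n⇒m⊓n≡m ≤)
  ... | no  ≰ = sym (m≥n⇒m⊓n≡n (<⇒≤ (≰⇒> ≰)))

  rpos≡ : ∀ (π : Arrangement n) e → rpos π e ≡ proj₂ (interval (pos π) e)
  rpos≡ π e with pos π (proj₁ e) ≤? pos π (proj₂ e)
  ... | yes ≤ = sym (m≤n⇒m⊔n≡n ≤)
  ... | no  ≰ = sym (m≥n⇒m⊔n≡m (<⇒≤ (≰⇒> ≰)))

  Cross⇒Crossing : ∀ (π : Arrangement n) e g → Cross π e g → Crossing (interval (pos π) e) (interval (pos π) g)
  Cross⇒Crossing π e g c rewrite sym (lpos≡ π e) | sym (lpos≡ π g) | sym (rpos≡ π e) | sym (rpos≡ π g) = c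

  PlanarAt⇒Planar : ∀ {E} (π : Arrangement n) → PlanarAt E (pos π) → Planar E π
  PlanarAt⇒Planar π planar e g e∈ g∈ = planar e∈ g∈ ∘ Cross⇒Crossing π e g

  Planar⇒PlanarAt : ∀ {E} (π : Arrangement n) → Planar E π → PlanarAt E (pos π)
  Planar⇒PlanarAt π planar {e} {g} e∈ g∈ c = planar e g e∈ g∈ (Crossing⇒Cross c)
    where
    Crossing⇒Cross : Crossing (interval (pos π) e) (interval (pos π) g) → Cross π e g
    Crossing⇒Cross c rewrite lpos≡ π e | lpos≡ π g | rpos≡ π e | rpos≡ π g = c

planar-cost≤ : ∀ {n} (E : EdgeList n) σ → IsTree n E → Planar E σ → cost E σ ≤ n C 2
planar-cost≤ {zero}  []      σ _                    _      = z≤n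
planar-cost≤ {suc N} E       σ ((loopless , E!) , _ , |E|≡N) planar = begin
  cost E σ                      ≡⟨ costAt≡sum-width E f ⟩
  sum (map width (map (interval f) E)) ≤⟨ laminar-width-sum≤ N (map (interval f) E) S! nc wide |S|≤N ⟩
  suc N C 2                     ∎
  where
  open ≤-Reasoning
  f = pos σ
  S! : Unique (map (interval f) E)
  S! = AllPairs.map⁺ (AllPairs.map (λ ¬same eq → ¬same (interval-injective (pos-injective σ) eq)) E!)
  nc : NonCrossing (map (interval f) E)
  nc x∈ y∈ with ∈-map⁻ (interval f) x∈ | ∈-map⁻ (interval f) y∈
  ... | e , e∈ , refl | g , g∈ , refl = Planar⇒PlanarAt σ planar e∈ g∈
  wide : All (WideIn 1 0 N) (map (interval f) E)
  wide = All.tabulate λ x∈ → case ∈-map⁻ (interval f) x∈ of λ where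
    ((a , b) , e∈ , refl) → z≤n
                          , subst (_≤ f a ⊔ f b) (+-comm 1 _) (interval-nonempty (pos-injective σ) (loopless (a , b) e∈))
                          , ⊔-lub (≤-pred (pos<n σ a)) (≤-pred (pos<n σ b))
  |S|≤N = ≤-reflexive (trans (length-map (interval f) E) |E|≡N)

injective⇒surjective : ∀ {n} (g : Fin n → Fin n) → (∀ {x y} → g x ≡ g y → x ≡ y) → ∀ y → ∃ λ x → g x ≡ y
injective⇒surjective {suc n} g g-injective y with F.any? (λ x → g x F≟ y)
... | yes hit = hit
... | no  miss = ⊥-elim (1+n≰n (F.injective⇒≤ {f = squeeze} squeeze-injective))
  where
  g≢y : ∀ x → y ≢ g x
  g≢y x y≡gx = miss (x , sym y≡gx)
  squeeze : Fin (suc n) → Fin n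
  squeeze x = F.punchOut (g≢y x)
  squeeze-injective : ∀ {x z} → squeeze x ≡ squeeze z → x ≡ z
  squeeze-injective eq = g-injective (F.punchOut-injective (g≢y _) (g≢y _) eq)

arrangementFrom : ∀ {n} (f : Fin n → ℕ) → (∀ v → f v < n) → (∀ {u v} → f u ≡ f v → u ≡ v) →
                  ∃ λ (π : Arrangement n) → ∀ v → pos π v ≡ f v
arrangementFrom {n} f f<n f-injective = π , λ v → F.toℕ-fromℕ< (f<n v)
  where
  g : Fin n → Fin n
  g v = F.fromℕ< (f<n v)
  g-injective : ∀ {u v} → g u ≡ g v → u ≡ v
  g-injective {u} {v} eq = f-injective (trans (sym (F.toℕ-fromℕ< (f<n u))) (trans (cong toℕ eq) (F.toℕ-fromℕ< (f<n v))))
  g⁻¹ : Fin n → Fin n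
  g⁻¹ y = proj₁ (injective⇒surjective g g-injective y)
  π : Arrangement n
  π = permutation g g⁻¹ (λ y → proj₂ (injective⇒surjective g g-injective y))
                        (λ x → g-injective (proj₂ (injective⇒surjective g g-injective (g x))))

[N∸x]∸[N∸y]≡y∸x : ∀ {N x y} → x ≤ y → y ≤ N → (N ∸ x) ∸ (N ∸ y) ≡ y ∸ x
[N∸x]∸[N∸y]≡y∸x {N} {x} {y} x≤y y≤N = begin
  (N ∸ x) ∸ (N ∸ y)               ≡⟨ cong (λ z → z ∸ x ∸ (N ∸ y)) (sym (m∸n+n≡m y≤N)) ⟩
  ((N ∸ y) + y ∸ x) ∸ (N ∸ y)     ≡⟨ cong (_∸ (N ∸ y)) (+-∸-assoc (N ∸ y) x≤y) ⟩
  ((N ∸ y) + (y ∸ x)) ∸ (N ∸ y)   ≡⟨ m+n∸m≡n (N ∸ y) (y ∸ x) ⟩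
  y ∸ x                           ∎
  where open ≡-Reasoning

∣[N∸x]-[N∸y]∣≡∣x-y∣ : ∀ {N x y} → x ≤ N → y ≤ N → ∣ (N ∸ x) - (N ∸ y) ∣ ≡ ∣ x - y ∣
∣[N∸x]-[N∸y]∣≡∣x-y∣ {N} {x} {y} x≤N y≤N with ≤-total x y
... | inj₁ x≤y = begin
  ∣ (N ∸ x) - (N ∸ y) ∣ ≡⟨ trans (∣-∣-comm (N ∸ x) (N ∸ y)) (m≤n⇒∣m-n∣≡n∸m (∸-monoʳ-≤ N x≤y)) ⟩
  (N ∸ x) ∸ (N ∸ y)     ≡⟨ [N∸x]∸[N∸y]≡y∸x x≤y y≤N ⟩
  y ∸ x                 ≡⟨ sym (m≤n⇒∣m-n∣≡n∸m x≤y) ⟩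
  ∣ x - y ∣             ∎
  where open ≡-Reasoning
... | inj₂ y≤x = begin
  ∣ (N ∸ x) - (N ∸ y) ∣ ≡⟨ m≤n⇒∣m-n∣≡n∸m (∸-monoʳ-≤ N y≤x) ⟩
  (N ∸ y) ∸ (N ∸ x)     ≡⟨ [N∸x]∸[N∸y]≡y∸x y≤x x≤N ⟩
  x ∸ y                 ≡⟨ sym (trans (∣-∣-comm x y) (m≤n⇒∣m-n∣≡n∸m y≤x)) ⟩
  ∣ x - y ∣             ∎
  where open ≡-Reasoning

module _ {n N : ℕ} {f : Fin n → ℕ} (f≤N : ∀ v → f v ≤ N) where

  private
    f̄ : Fin n → ℕ
    f̄ v = N ∸ f v

  mirror-injective : (∀ {u v} → f u ≡ f v → u ≡ v) → ∀ {u v} → f̄ u ≡ f̄ v → u ≡ v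
  mirror-injective f-injective eq = f-injective (∸-cancelˡ-≡ (f≤N _) (f≤N _) eq)

  costAt-mirror : ∀ E → costAt E f̄ ≡ costAt E f
  costAt-mirror []      = refl
  costAt-mirror (e ∷ E) = cong₂ _+_ (∣[N∸x]-[N∸y]∣≡∣x-y∣ (f≤N (proj₁ e)) (f≤N (proj₂ e))) (costAt-mirror E)

  PlanarAt-mirror : ∀ {E} → PlanarAt E f̄ → PlanarAt E f
  PlanarAt-mirror planar {e} {g} e∈ g∈ (l₁<l₂ , l₂<r₁ , r₁<r₂) =
    planar g∈ e∈ (subst₂ Crossing (sym (interval-mirror g)) (sym (interval-mirror e))
      (∸-monoʳ-< r₁<r₂ (≤-max g) , ∸-monoʳ-< l₂<r₁ (≤-max e) , ∸-monoʳ-< l₁<l₂ (≤-trans (m⊓n≤m _ _) (f≤N (proj₁ g)))))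
    where
    ≤-max : ∀ e → proj₂ (interval f e) ≤ N
    ≤-max e = ⊔-lub (f≤N (proj₁ e)) (f≤N (proj₂ e))
    interval-mirror : ∀ e → interval f̄ e ≡ (N ∸ proj₂ (interval f e) , N ∸ proj₁ (interval f e))
    interval-mirror e = cong₂ _,_ (sym (∸-distribˡ-⊔-⊓ N (f (proj₁ e)) (f (proj₂ e))))
                                  (sym (∸-distribˡ-⊓-⊔ N (f (proj₁ e)) (f (proj₂ e))))

-- Caterpillars

adj-sym : ∀ {n} {E : EdgeList n} {u v} → Adj E u v → Adj E v u
adj-sym (inj₁ uv∈) = inj₂ uv∈
adj-sym (inj₂ vu∈) = inj₁ vu∈

module Leaves {n : ℕ} (E : EdgeList n) where

  edgeOf : ∀ {u v} → Adj E u v → Edge n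
  edgeOf {u} {v} (inj₁ _) = (u , v)
  edgeOf {u} {v} (inj₂ _) = (v , u)

  edgeOf-incident : ∀ {u v} (a : Adj E u v) → edgeOf a ∈ filter (Incident? u) E
  edgeOf-incident (inj₁ uv∈) = ∈-filter⁺ (Incident? _) uv∈ (inj₁ refl)
  edgeOf-incident (inj₂ vu∈) = ∈-filter⁺ (Incident? _) vu∈ (inj₂ refl)

  edgeOf-injective : ∀ {u v w} (a : Adj E u v) (b : Adj E u w) → edgeOf a ≡ edgeOf b → v ≡ w
  edgeOf-injective (inj₁ _) (inj₁ _) refl = refl
  edgeOf-injective (inj₁ _) (inj₂ _) refl = refl
  edgeOf-injective (inj₂ _) (inj₁ _) refl = refl
  edgeOf-injective (inj₂ _) (inj₂ _) refl = refl

  leaf-neighbour-unique : ∀ {u v w} → Leaf E u → Adj E u v → Adj E u w → v ≡ w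
  leaf-neighbour-unique {u} {v} {w} leaf a b with v F≟ w
  ... | yes v≡w = v≡w
  ... | no  v≢w = ⊥-elim (1+n≰n (subst (2 ≤_) leaf two-incident))
    where
    two-incident : 2 ≤ length (filter (Incident? u) E)
    two-incident = Unique-⊆⇒length≤ (≡-dec F._≟_ F._≟_) (((v≢w ∘ edgeOf-injective a b) ∷ []) ∷ [] ∷ [])
      λ { (here refl) → edgeOf-incident a ; (there (here refl)) → edgeOf-incident b }

  leaf-neighbour : ∀ {u} → Leaf E u → ∃ λ v → Adj E u v
  leaf-neighbour {u} leaf with filter (Incident? u) E in eq
  ... | e ∷ _ with ∈-filter⁻ (Incident? u) {xs = E} (subst (e ∈_) (sym eq) (here refl))
  ...   | e∈ , inj₁ refl = proj₂ e , inj₁ e∈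
  ...   | e∈ , inj₂ refl = proj₁ e , inj₂ e∈

  -- two adjacent leaves form a whole connected component
  leaf-neighbour-not-leaf : 3 ≤ n → Connected E → ∀ {u v} → Leaf E u → Adj E u v → ¬ Leaf E v
  leaf-neighbour-not-leaf (s≤s (s≤s (s≤s _))) connected {u} {v} u-leaf a v-leaf
    with only-u-v zero | only-u-v (suc zero) | only-u-v (suc (suc zero))
    where
    only-u-v : ∀ x → (x ≡ u) ⊎ (x ≡ v)
    only-u-v x = walk (inj₁ refl) (connected u x)
      where
      walk : ∀ {y z} → (y ≡ u) ⊎ (y ≡ v) → Reach E y z → (z ≡ u) ⊎ (z ≡ v)
      walk y∈ here = y∈
      walk (inj₁ refl) (step b r) = walk (inj₂ (leaf-neighbour-unique u-leaf b a)) r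
      walk (inj₂ refl) (step b r) = walk (inj₁ (leaf-neighbour-unique v-leaf b (adj-sym a))) r
  ... | inj₁ refl | inj₁ ()   | _
  ... | inj₁ refl | inj₂ refl | inj₁ ()
  ... | inj₁ refl | inj₂ refl | inj₂ ()
  ... | inj₂ refl | inj₂ ()   | _
  ... | inj₂ refl | inj₁ refl | inj₁ ()
  ... | inj₂ refl | inj₁ refl | inj₂ ()

leavesOf : ∀ {n} → EdgeList n → Fin n → List (Fin n)
leavesOf {n} E w = filter (λ u → Leaf? E u ×-dec Adj? E u w) (allFin n)

blockTotal : (m : ℕ) → (Fin (suc m) → ℕ) → ℕ
blockTotal zero    L = suc (L zero)
blockTotal (suc m) L = suc (L zero) + blockTotal m (L ∘ suc)

∣m-n∣≡1⇒n≡1+m⊎m≡1+n : ∀ {m n} → ∣ m - n ∣ ≡ 1 → n ≡ suc m ⊎ m ≡ suc n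
∣m-n∣≡1⇒n≡1+m⊎m≡1+n {zero}        {suc zero} _ = inj₁ refl
∣m-n∣≡1⇒n≡1+m⊎m≡1+n {suc zero}    {zero}     _ = inj₂ refl
∣m-n∣≡1⇒n≡1+m⊎m≡1+n {suc m}       {suc n}    eq with ∣m-n∣≡1⇒n≡1+m⊎m≡1+n {m} {n} eq
... | inj₁ n≡1+m = inj₁ (cong suc n≡1+m)
... | inj₂ m≡1+n = inj₂ (cong suc m≡1+n)

module Caterpillar {n : ℕ} (E : EdgeList n) (tree : IsTree n E) (3≤n : 3 ≤ n)
                   (m : ℕ) (bb : Fin (suc m) → Fin n) (backbone : IsBackbone n E m bb) where

  open Leaves E

  connected : Connected E
  connected = proj₁ (proj₂ tree)

  bb-injective : ∀ {i j} → bb i ≡ bb j → i ≡ j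
  bb-injective = proj₁ backbone

  bb-not-leaf : ∀ k → ¬ Leaf E (bb k)
  bb-not-leaf = proj₁ (proj₂ backbone)

  not-leaf⇒bb : ∀ v → ¬ Leaf E v → ∃ λ k → bb k ≡ v
  not-leaf⇒bb = proj₁ (proj₂ (proj₂ backbone))

  bb-adjacent⇒consecutive : ∀ i j → Adj E (bb i) (bb j) → ∣ toℕ i - toℕ j ∣ ≡ 1
  bb-adjacent⇒consecutive i j = proj₁ (proj₂ (proj₂ (proj₂ backbone)) i j)

  leaf-attached : ∀ {u} → Leaf E u → ∃ λ k → Adj E u (bb k)
  leaf-attached u-leaf with leaf-neighbour u-leaf
  ... | v , a with not-leaf⇒bb v (leaf-neighbour-not-leaf 3≤n connected u-leaf a)
  ...   | k , refl = k , a

  leaf-attached-unique : ∀ {u i j} → Leaf E u → Adj E u (bb i) → Adj E u (bb j) → i ≡ j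
  leaf-attached-unique u-leaf a b = bb-injective (leaf-neighbour-unique u-leaf a b)

  -- every edge {bb k , w} is charged to the later of its backbone endpoints
  data Charged (k : Fin (suc m)) (w : Fin n) : Set where
    leaf  : Leaf E w → Adj E w (bb k) → Charged k w
    spine : ∀ i → toℕ k ≡ suc (toℕ i) → w ≡ bb i → Charged k w

  UnorderedEdge : Edge n → Fin n → Fin n → Set
  UnorderedEdge e u v = e ≡ (u , v) ⊎ e ≡ (v , u)

  classify : ∀ {e} → e ∈ E → ∃ λ k → ∃ λ w → Charged k w × UnorderedEdge e (bb k) w
  classify {x , y} e∈ with Leaf? E x | Leaf? E y
  ... | yes x-leaf | _ with not-leaf⇒bb y (leaf-neighbour-not-leaf 3≤n connected x-leaf (inj₁ e∈))
  ...   | k , refl = k , x , leaf x-leaf (inj₁ e∈) , inj₂ refl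
  classify {x , y} e∈ | no _ | yes y-leaf with not-leaf⇒bb x (leaf-neighbour-not-leaf 3≤n connected y-leaf (inj₂ e∈))
  ...   | k , refl = k , y , leaf y-leaf (inj₂ e∈) , inj₁ refl
  classify {x , y} e∈ | no x-spine | no y-spine with not-leaf⇒bb x x-spine | not-leaf⇒bb y y-spine
  ... | i , refl | j , refl with ∣m-n∣≡1⇒n≡1+m⊎m≡1+n (bb-adjacent⇒consecutive i j (inj₁ e∈))
  ...   | inj₁ j≡1+i = j , bb i , spine i j≡1+i refl , inj₂ refl
  ...   | inj₂ i≡1+j = i , bb j , spine j i≡1+j refl , inj₁ refl

  leavesOf-leaf : ∀ {w u} → u ∈ leavesOf E w → Leaf E u × Adj E u w
  leavesOf-leaf {w} u∈ = proj₂ (∈-filter⁻ (λ u → Leaf? E u ×-dec Adj? E u w) {xs = allFin n} u∈)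

  leaf∈leavesOf : ∀ {w u} → Leaf E u → Adj E u w → u ∈ leavesOf E w
  leaf∈leavesOf {w} {u} u-leaf a = ∈-filter⁺ (λ u → Leaf? E u ×-dec Adj? E u w) (∈-allFin u) (u-leaf , a)

  blocks : (m' : ℕ) → (Fin (suc m') → Fin n) → List (Fin n)
  blocks zero     b = b zero ∷ leavesOf E (b zero)
  blocks (suc m') b = (b zero ∷ leavesOf E (b zero)) ++ blocks m' (b ∘ suc)

  length-blocks : ∀ m' b → length (blocks m' b) ≡ blockTotal m' (leafCount E ∘ b)
  length-blocks zero     b = refl
  length-blocks (suc m') b = trans (length-++ (b zero ∷ leavesOf E (b zero)))
                                   (cong (suc (leafCount E (b zero)) +_) (length-blocks m' (b ∘ suc)))

  ∈-blocks⁻ : ∀ m' b {x} → x ∈ blocks m' b → ∃ λ k → x ≡ b k ⊎ x ∈ leavesOf E (b k)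
  ∈-blocks⁻ zero     b (here refl) = zero , inj₁ refl
  ∈-blocks⁻ zero     b (there x∈)  = zero , inj₂ x∈
  ∈-blocks⁻ (suc m') b x∈ with ∈-++⁻ (b zero ∷ leavesOf E (b zero)) x∈
  ... | inj₁ (here refl) = zero , inj₁ refl
  ... | inj₁ (there x∈′) = zero , inj₂ x∈′
  ... | inj₂ x∈′ = let k , x∈k = ∈-blocks⁻ m' (b ∘ suc) x∈′ in suc k , x∈k

  bb∈blocks : ∀ m' b k → b k ∈ blocks m' b
  bb∈blocks zero     b zero    = here refl
  bb∈blocks (suc m') b zero    = here refl
  bb∈blocks (suc m') b (suc k) = ∈-++⁺ʳ (b zero ∷ leavesOf E (b zero)) (bb∈blocks m' (b ∘ suc) k)

  leaf∈blocks : ∀ m' b k {x} → x ∈ leavesOf E (b k) → x ∈ blocks m' b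
  leaf∈blocks zero     b zero    x∈ = there x∈
  leaf∈blocks (suc m') b zero    x∈ = there (∈-++⁺ˡ x∈)
  leaf∈blocks (suc m') b (suc k) x∈ = ∈-++⁺ʳ (b zero ∷ leavesOf E (b zero)) (leaf∈blocks m' (b ∘ suc) k x∈)

  blocks-unique : ∀ m' b → (∀ {i j} → b i ≡ b j → i ≡ j) → (∀ k → ¬ Leaf E (b k)) → Unique (blocks m' b)
  blocks-unique zero b _ b-not-leaf =
    All.tabulate (λ x∈ b≡x → b-not-leaf zero (subst (Leaf E) (sym b≡x) (proj₁ (leavesOf-leaf x∈))))
    ∷ Unique.filter⁺ _ (Unique.allFin⁺ n)
  blocks-unique (suc m') b b-injective b-not-leaf =
    Unique.++⁺ (blocks-unique zero (λ _ → b zero) (λ { {zero} {zero} _ → refl }) (λ _ → b-not-leaf zero))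
               (blocks-unique m' (b ∘ suc) (F.suc-injective ∘ b-injective) (b-not-leaf ∘ suc))
               disjoint
    where
    disjoint : ∀ {x} → x ∈ b zero ∷ leavesOf E (b zero) × x ∈ blocks m' (b ∘ suc) → ⊥
    disjoint (x∈ , y∈) with x∈ | ∈-blocks⁻ m' (b ∘ suc) y∈
    ... | here refl | k , inj₁ eq with b-injective eq
    ...   | ()
    disjoint (x∈ , y∈) | here refl | k , inj₂ y∈′ = b-not-leaf zero (proj₁ (leavesOf-leaf y∈′))
    disjoint (x∈ , y∈) | there x∈′ | k , inj₁ refl = b-not-leaf (suc k) (proj₁ (leavesOf-leaf x∈′))
    disjoint (x∈ , y∈) | there x∈′ | k , inj₂ y∈′ with b-injective (leaf-neighbour-unique
                                                        (proj₁ (leavesOf-leaf x∈′)) (proj₂ (leavesOf-leaf x∈′)) (proj₂ (leavesOf-leaf y∈′)))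
    ...   | ()

  vertex-count : blockTotal m (leafCount E ∘ bb) ≡ n
  vertex-count = ≤-antisym
    (subst₂ _≤_ (length-blocks m bb) (length-tabulate (λ v → v))
      (Unique-⊆⇒length≤ _F≟_ (blocks-unique m bb bb-injective bb-not-leaf) (λ {v} _ → ∈-allFin v)))
    (subst₂ _≤_ (length-tabulate (λ v → v)) (length-blocks m bb)
      (Unique-⊆⇒length≤ _F≟_ (Unique.allFin⁺ n) (λ {v} _ → vertex∈blocks v)))
    where
    vertex∈blocks : ∀ v → v ∈ blocks m bb
    vertex∈blocks v with Leaf? E v
    ... | yes v-leaf = let k , a = leaf-attached v-leaf in leaf∈blocks m bb k (leaf∈leavesOf v-leaf a)
    ... | no  v-spine = let k , bb≡v = not-leaf⇒bb v v-spine in subst (_∈ blocks m bb) bb≡v (bb∈blocks m bb k)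

IsBackbone-reverse : ∀ {n E m bb} → IsBackbone n E m bb → IsBackbone n E m (bb ∘ F.opposite)
IsBackbone-reverse {m = m} {bb} (bb-injective , bb-not-leaf , not-leaf⇒bb , bb-adjacent) =
  (λ eq → trans (sym (F.opposite-involutive _)) (trans (cong F.opposite (bb-injective eq)) (F.opposite-involutive _))) ,
  bb-not-leaf ∘ F.opposite ,
  (λ v v-spine → let k , bb≡v = not-leaf⇒bb v v-spine in F.opposite k , trans (cong bb (F.opposite-involutive k)) bb≡v) ,
  λ i j → (λ a → trans (sym (∣opposite∣ i j)) (proj₁ (bb-adjacent (F.opposite i) (F.opposite j)) a)) ,
          (λ d → proj₂ (bb-adjacent (F.opposite i) (F.opposite j)) (trans (∣opposite∣ i j) d))
  where
  ∣opposite∣ : ∀ (i j : Fin (suc m)) → ∣ toℕ (F.opposite i) - toℕ (F.opposite j) ∣ ≡ ∣ toℕ i - toℕ j ∣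
  ∣opposite∣ i j rewrite F.opposite-prop i | F.opposite-prop j =
    ∣[N∸x]-[N∸y]∣≡∣x-y∣ (≤-pred (toℕ<n i)) (≤-pred (toℕ<n j))

-- Rosa's construction

State : Set
State = ℕ × ℕ × Side

next : State → ℕ → State
next (a , b , s) L = proj₂ (rosaStep a b s L)

spinePos : State → ℕ
spinePos (a , b , left)  = a
spinePos (a , b , right) = b

blockStartOf : State → ℕ → ℕ
blockStartOf (a , b , left)  L = suc b ∸ L
blockStartOf (a , b , right) L = a

-- the span of a step runs from the previous backbone vertex to the far end of the free interval
prevPos spanLo spanHi freeLo freeHi : State → ℕ
prevPos (a , b , left)  = suc b
prevPos (a , b , right) = a ∸ 1
spanLo  (a , b , left)  = a
spanLo  (a , b , right) = a ∸ 1
spanHi  (a , b , left)  = suc b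
spanHi  (a , b , right) = b
freeLo  (a , b , _)     = a
freeHi  (a , b , _)     = b

InBlock : State → ℕ → ℕ → Set
InBlock x L o = blockStartOf x L ≤ o × o < blockStartOf x L + L

Neighbour : State → ℕ → ℕ → Set
Neighbour x L o = InBlock x L o ⊎ o ≡ prevPos x

-- the next block fits into the free interval with t positions to spare; on the right side a > 0,
-- so that prevPos = a ∸ 1 is not truncated
data Fits : State → ℕ → Set where
  fits-left  : ∀ a t L → Fits (a , a + (L + t) , left) L
  fits-right : ∀ a t L → Fits (suc a , suc a + (L + t) , right) L

Valid : State → (m : ℕ) → (Fin (suc m) → ℕ) → Set
Valid (a , b , s) m L = a + blockTotal m L ≡ suc b × (s ≡ right → 1 ≤ a)

a+[L+t]∸L≡a+t : ∀ a L t → a + (L + t) ∸ L ≡ a + t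
a+[L+t]∸L≡a+t a L t = begin
  a + (L + t) ∸ L ≡⟨ cong (_∸ L) (trans (sym (+-assoc a L t)) (trans (cong (_+ t) (+-comm a L)) (+-assoc L a t))) ⟩
  L + (a + t) ∸ L ≡⟨ m+n∸m≡n L (a + t) ⟩
  a + t           ∎
  where open ≡-Reasoning

1+a+[L+t]∸L≡1+a+t : ∀ a L t → suc (a + (L + t)) ∸ L ≡ suc (a + t)
1+a+[L+t]∸L≡1+a+t a L t = a+[L+t]∸L≡a+t (suc a) L t

fits : ∀ {a b s L} t → a + (L + t) ≡ b → (s ≡ right → 1 ≤ a) → Fits (a , b , s) L
fits {s = left}          t refl _   = fits-left _ t _
fits {suc a} {s = right} t refl _   = fits-right a t _
fits {zero}  {s = right} t _    1≤a with 1≤a refl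
... | ()

Valid⇒Fits : ∀ x m L → Valid x m L → Fits x (L zero)
Valid⇒Fits (a , b , s) zero    L (eq , 1≤a) = fits 0 (suc-injective (trans (sym (+-suc a _)) (trans (cong (λ z → a + suc z) (+-identityʳ _)) eq))) 1≤a
Valid⇒Fits (a , b , s) (suc m) L (eq , 1≤a) = fits (blockTotal m (L ∘ suc)) (suc-injective (trans (sym (+-suc a _)) eq)) 1≤a

Valid-next : ∀ x m L → Valid x (suc m) L → Valid (next x (L zero)) m (L ∘ suc)
Valid-next (a , b , left) m L (eq , _) =
  cong suc (sym (trans (cong (_∸ L zero) (sym a+[L₀+T]≡b)) (a+[L+t]∸L≡a+t a (L zero) T))) , λ _ → s≤s z≤n
  where
  T = blockTotal m (L ∘ suc)
  a+[L₀+T]≡b = suc-injective (trans (sym (+-suc a _)) eq)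
Valid-next (a , b , right) m L (eq , 1≤a) =
  trans (+-assoc a (L zero) T) (trans a+[L₀+T]≡b (sym (m+[n∸m]≡n 1≤b))) , λ ()
  where
  T = blockTotal m (L ∘ suc)
  a+[L₀+T]≡b = suc-injective (trans (sym (+-suc a _)) eq)
  1≤b = ≤-trans (1≤a refl) (≤-trans (m≤m+n a _) (≤-reflexive a+[L₀+T]≡b))

Shrinks : State → State → Set
Shrinks y x = spanLo x ≤ spanLo y × spanHi y ≤ spanHi x × freeLo x ≤ freeLo y × freeHi y ≤ freeHi x

Shrinks-refl : ∀ x → Shrinks x x
Shrinks-refl x = ≤-refl , ≤-refl , ≤-refl , ≤-refl

Shrinks-trans : ∀ {x y z} → Shrinks x y → Shrinks y z → Shrinks x z
Shrinks-trans (a , b , c , d) (a' , b' , c' , d') = ≤-trans a' a , ≤-trans b b' , ≤-trans c' c , ≤-trans d d'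

FilledAt : State → ℕ → ℕ → Set
FilledAt x L p = (freeLo x ≤ p × p ≤ freeHi x) × (p < freeLo (next x L) ⊎ freeHi (next x L) < p)

neighbour-left : ∀ a t L {o} → Neighbour (a , a + (L + t) , left) L o → suc (a + t) ≤ o × o ≤ suc (a + (L + t))
neighbour-left a t L {o} (inj₁ (start≤o , o<end)) rewrite 1+a+[L+t]∸L≡1+a+t a L t =
  start≤o , <⇒≤ (subst (o <_) (cong suc (trans (+-assoc a t L) (cong (a +_) (+-comm t L)))) o<end)
neighbour-left a t L (inj₂ refl) = s≤s (+-monoʳ-≤ a (m≤n+m t L)) , ≤-refl

inBlock-left : ∀ a t L {o} → InBlock (a , a + (L + t) , left) L o → suc (a + t) ≤ o × o ≤ a + (L + t)
inBlock-left a t L {o} (start≤o , o<end) rewrite 1+a+[L+t]∸L≡1+a+t a L t =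
  start≤o , ≤-pred (subst (o <_) (cong suc (trans (+-assoc a t L) (cong (a +_) (+-comm t L)))) o<end)

neighbour-right : ∀ a t L {o} → Neighbour (suc a , suc a + (L + t) , right) L o → a ≤ o × o < suc a + L
neighbour-right a t L (inj₁ (start≤o , o<end)) = ≤-trans (n≤1+n a) start≤o , o<end
neighbour-right a t L (inj₂ refl) = ≤-refl , s≤s (m≤m+n a L)

spine∈span : ∀ {x L} → Fits x L → spanLo x ≤ spinePos x × spinePos x ≤ spanHi x
spine∈span (fits-left a t L)  = ≤-refl , ≤-trans (m≤m+n a _) (n≤1+n _)
spine∈span (fits-right a t L) = ≤-trans (n≤1+n a) (m≤m+n (suc a) _) , ≤-refl

neighbour∈span : ∀ {x L o} → Fits x L → Neighbour x L o → spanLo x ≤ o × o ≤ spanHi x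
neighbour∈span (fits-left a t L) nb =
  let a+t<o , o≤ = neighbour-left a t L nb in ≤-trans (≤-trans (m≤m+n a t) (n≤1+n _)) a+t<o , o≤
neighbour∈span (fits-right a t L) nb =
  let a≤o , o< = neighbour-right a t L nb in a≤o , <⇒≤ (≤-trans o< (+-monoʳ-≤ (suc a) (m≤m+n L t)))

-- every edge at this step spans everything placed later
span-next⊆edge : ∀ {x L o} → Fits x L → Neighbour x L o →
                 spinePos x ⊓ o ≤ spanLo (next x L) × spanHi (next x L) ≤ spinePos x ⊔ o
span-next⊆edge {o = o} (fits-left a t L) nb rewrite a+[L+t]∸L≡a+t a L t =
  let a+t<o , _ = neighbour-left a t L nb in m⊓n≤m a o , ≤-trans (<⇒≤ a+t<o) (m≤n⊔m a o)
span-next⊆edge {o = o} (fits-right a t L) nb =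
  let _ , o< = neighbour-right a t L nb in ≤-trans (m⊓n≤n _ o) (<⇒≤ o<) , m≤m⊔n _ o

span-next<edge : ∀ {x L o} → Fits x L → Neighbour x L o → spanHi (next x L) ∸ spanLo (next x L) < ∣ spinePos x - o ∣
span-next<edge {o = o} (fits-left a t L) nb rewrite a+[L+t]∸L≡a+t a L t with neighbour-left a t L nb
... | a+t<o , _ rewrite m+n∸m≡n a t | m≤n⇒∣m-n∣≡n∸m (≤-trans (≤-trans (m≤m+n a t) (n≤1+n _)) a+t<o) =
  m+n≤o⇒m≤o∸n (suc t) (subst (_≤ o) (cong suc (+-comm a t)) a+t<o)
span-next<edge {o = o} (fits-right a t L) nb with neighbour-right a t L nb
... | _ , o< rewrite trans (∣-∣-comm (suc a + (L + t)) o) (m≤n⇒∣m-n∣≡n∸m (<⇒≤ (≤-trans o< (+-monoʳ-≤ (suc a) (m≤m+n L t))))) =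
  ∸-monoʳ-< o< (+-monoʳ-≤ (suc a) (m≤m+n L t))

-- all neighbours at one step lie on the same side of the backbone vertex
neighbour-distance-injective : ∀ {x L o₁ o₂} → Fits x L → Neighbour x L o₁ → Neighbour x L o₂ →
                               ∣ spinePos x - o₁ ∣ ≡ ∣ spinePos x - o₂ ∣ → o₁ ≡ o₂
neighbour-distance-injective (fits-left a t L) nb₁ nb₂ eq =
  ∸-cancelʳ-≡ (a≤ nb₁) (a≤ nb₂) (trans (sym (m≤n⇒∣m-n∣≡n∸m (a≤ nb₁))) (trans eq (m≤n⇒∣m-n∣≡n∸m (a≤ nb₂))))
  where
  a≤ : ∀ {o} → Neighbour (a , a + (L + t) , left) L o → a ≤ o
  a≤ nb = ≤-trans (≤-trans (m≤m+n a t) (n≤1+n _)) (proj₁ (neighbour-left a t L nb))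
neighbour-distance-injective (fits-right a t L) nb₁ nb₂ eq =
  ∸-cancelˡ-≡ (≤P nb₁) (≤P nb₂) (trans (sym (∣P-o∣ nb₁)) (trans eq (∣P-o∣ nb₂)))
  where
  ≤P : ∀ {o} → Neighbour (suc a , suc a + (L + t) , right) L o → o ≤ suc a + (L + t)
  ≤P nb = <⇒≤ (≤-trans (proj₂ (neighbour-right a t L nb)) (+-monoʳ-≤ (suc a) (m≤m+n L t)))
  ∣P-o∣ : ∀ {o} → Neighbour (suc a , suc a + (L + t) , right) L o → ∣ suc a + (L + t) - o ∣ ≡ suc a + (L + t) ∸ o
  ∣P-o∣ {o} nb = trans (∣-∣-comm (suc a + (L + t)) o) (m≤n⇒∣m-n∣≡n∸m (≤P nb))

prevPos-next : ∀ {x L} → Fits x L → prevPos (next x L) ≡ spinePos x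
prevPos-next (fits-left a t L)  = refl
prevPos-next (fits-right a t L) = refl

next-Shrinks : ∀ {x L} → Fits x L → Shrinks (next x L) x
next-Shrinks (fits-left a t L)  = ≤-refl , ≤-trans (m∸n≤m _ L) (n≤1+n _) , n≤1+n a , m∸n≤m _ L
next-Shrinks (fits-right a t L) = ≤-trans (n≤1+n a) (m≤m+n (suc a) L) , ≤-refl , m≤m+n (suc a) L , n≤1+n _

spine-FilledAt : ∀ {x L} → Fits x L → FilledAt x L (spinePos x)
spine-FilledAt (fits-left a t L)  = (≤-refl , m≤m+n a _) , inj₁ ≤-refl
spine-FilledAt (fits-right a t L) = (m≤m+n (suc a) _ , ≤-refl) , inj₂ ≤-refl

block-FilledAt : ∀ {x L o} → Fits x L → InBlock x L o → FilledAt x L o × o ≢ spinePos x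
block-FilledAt {o = o} (fits-left a t L) inb with inBlock-left a t L inb
... | a+t<o , o≤ rewrite a+[L+t]∸L≡a+t a L t =
  ((≤-trans (≤-trans (m≤m+n a t) (n≤1+n _)) a+t<o , o≤) , inj₂ a+t<o) ,
  λ o≡a → 1+n≰n (≤-trans (s≤s (m≤m+n a t)) (subst (_ ≤_) o≡a a+t<o))
block-FilledAt {o = o} (fits-right a t L) (start≤o , o<end) =
  ((start≤o , <⇒≤ o<P) , inj₁ o<end) , λ o≡P → <-irrefl o≡P o<P
  where o<P = ≤-trans o<end (+-monoʳ-≤ (suc a) (m≤m+n L t))

stateAt : State → (m : ℕ) → (Fin (suc m) → ℕ) → Fin (suc m) → State
stateAt x m       L zero    = x
stateAt x (suc m) L (suc k) = stateAt (next x (L zero)) m (L ∘ suc) k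

rosa≡stateAt : ∀ a b s m L k → rosa a b s (suc m) L k ≡
               (spinePos (stateAt (a , b , s) m L k) , blockStartOf (stateAt (a , b , s) m L k) (L k) , L k)
rosa≡stateAt a b left  m       L zero    = refl
rosa≡stateAt a b right m       L zero    = refl
rosa≡stateAt a b left  (suc m) L (suc k) = rosa≡stateAt _ _ _ m (L ∘ suc) k
rosa≡stateAt a b right (suc m) L (suc k) = rosa≡stateAt _ _ _ m (L ∘ suc) k

stateAt-Fits : ∀ x m L → Valid x m L → ∀ k → Fits (stateAt x m L k) (L k)
stateAt-Fits x m       L valid zero    = Valid⇒Fits x m L valid
stateAt-Fits x (suc m) L valid (suc k) = stateAt-Fits (next x (L zero)) m (L ∘ suc) (Valid-next x m L valid) k

stateAt-next : ∀ x m L (i j : Fin (suc m)) → toℕ j ≡ suc (toℕ i) → stateAt x m L j ≡ next (stateAt x m L i) (L i)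
stateAt-next x (suc m) L zero    (suc zero)    _  = refl
stateAt-next x (suc m) L (suc i) (suc j)       eq = stateAt-next (next x (L zero)) m (L ∘ suc) i j (suc-injective eq)
stateAt-next x (suc m) L zero    (suc (suc j)) ()
stateAt-next x zero    L zero    zero          ()

stateAt-Shrinks : ∀ x m L → Valid x m L → ∀ k → Shrinks (stateAt x m L k) x
stateAt-Shrinks x m       L valid zero    = Shrinks-refl x
stateAt-Shrinks x (suc m) L valid (suc k) =
  Shrinks-trans {stateAt (next x (L zero)) m (L ∘ suc) k} {next x (L zero)} {x} (stateAt-Shrinks (next x (L zero)) m (L ∘ suc) (Valid-next x m L valid) k)
                (next-Shrinks (Valid⇒Fits x (suc m) L valid))

stateAt-Shrinks-next : ∀ x m L → Valid x m L → ∀ i j → toℕ i < toℕ j →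
                       Shrinks (stateAt x m L j) (next (stateAt x m L i) (L i))
stateAt-Shrinks-next x (suc m) L valid zero    (suc j) _         =
  stateAt-Shrinks (next x (L zero)) m (L ∘ suc) (Valid-next x m L valid) j
stateAt-Shrinks-next x (suc m) L valid (suc i) (suc j) (s≤s i<j) =
  stateAt-Shrinks-next (next x (L zero)) m (L ∘ suc) (Valid-next x m L valid) i j i<j

module RosaLayout {n : ℕ} (E : EdgeList n) (tree : IsTree n E) (3≤n : 3 ≤ n)
                  (m : ℕ) (bb : Fin (suc m) → Fin n) (backbone : IsBackbone n E m bb) where

  open Caterpillar E tree 3≤n m bb backbone public

  L : Fin (suc m) → ℕ
  L k = leafCount E (bb k)

  start : State
  start = (0 , n ∸ 1 , left)

  st : Fin (suc m) → State
  st k = stateAt start m L k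

  1+[n∸1]≡n : suc (n ∸ 1) ≡ n
  1+[n∸1]≡n = m+[n∸m]≡n (≤-trans (s≤s z≤n) 3≤n)

  start-Valid : Valid start m L
  start-Valid = trans vertex-count (sym 1+[n∸1]≡n) , λ ()

  st-Fits : ∀ k → Fits (st k) (L k)
  st-Fits = stateAt-Fits start m L start-Valid

  P : Fin (suc m) → ℕ
  P k = spinePos (st k)

  Nb : Fin (suc m) → ℕ → Set
  Nb k = Neighbour (st k) (L k)

  later-within-span : ∀ {i j oⱼ} → toℕ i < toℕ j → Nb j oⱼ →
                      spanLo (next (st i) (L i)) ≤ P j ⊓ oⱼ × P j ⊔ oⱼ ≤ spanHi (next (st i) (L i))
  later-within-span {i} {j} i<j nbⱼ with stateAt-Shrinks-next start m L start-Valid i j i<j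
  ... | lo≤ , hi≤ , _ =
    ≤-trans lo≤ (⊓-glb (proj₁ spine∈) (proj₁ nb∈)) , ≤-trans (⊔-lub (proj₂ spine∈) (proj₂ nb∈)) hi≤
    where
    spine∈ = spine∈span (st-Fits j)
    nb∈ = neighbour∈span (st-Fits j) nbⱼ

  later-nested : ∀ {i j oᵢ oⱼ} → toℕ i < toℕ j → Nb i oᵢ → Nb j oⱼ →
                 P i ⊓ oᵢ ≤ P j ⊓ oⱼ × P j ⊔ oⱼ ≤ P i ⊔ oᵢ
  later-nested {i} i<j nbᵢ nbⱼ =
    let edge-lo , edge-hi = span-next⊆edge (st-Fits i) nbᵢ
        lo≤ , ≤hi = later-within-span i<j nbⱼ
    in ≤-trans edge-lo lo≤ , ≤-trans ≤hi edge-hi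

  later-shorter : ∀ {i j oᵢ oⱼ} → toℕ i < toℕ j → Nb i oᵢ → Nb j oⱼ → ∣ P j - oⱼ ∣ < ∣ P i - oᵢ ∣
  later-shorter {i} {j} {oⱼ = oⱼ} i<j nbᵢ nbⱼ = begin-strict
    ∣ P j - oⱼ ∣                                              ≡⟨ ∣m-n∣≡m⊔n∸m⊓n (P j) oⱼ ⟩
    P j ⊔ oⱼ ∸ P j ⊓ oⱼ                                       ≤⟨ ∸-mono ≤hi lo≤ ⟩
    spanHi (next (st i) (L i)) ∸ spanLo (next (st i) (L i))   <⟨ span-next<edge (st-Fits i) nbᵢ ⟩
    ∣ P i - _ ∣                                               ∎
    where
    open ≤-Reasoning
    lo≤ = proj₁ (later-within-span i<j nbⱼ)
    ≤hi = proj₂ (later-within-span i<j nbⱼ)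

  edges-non-crossing : ∀ {i j oᵢ oⱼ} → Nb i oᵢ → Nb j oⱼ → ¬ Crossing (P i ⊓ oᵢ , P i ⊔ oᵢ) (P j ⊓ oⱼ , P j ⊔ oⱼ)
  edges-non-crossing {i} {j} {oᵢ} {oⱼ} nbᵢ nbⱼ with <-cmp (toℕ i) (toℕ j)
  ... | tri< i<j _ _ = let lo≤ , hi≤ = later-nested i<j nbᵢ nbⱼ in proj₁ (nested⇒¬Crossing lo≤ hi≤)
  ... | tri> _ _ j<i = let lo≤ , hi≤ = later-nested j<i nbⱼ nbᵢ in proj₂ (nested⇒¬Crossing lo≤ hi≤)
  ... | tri≈ _ i≡j _ with toℕ-injective i≡j
  ...   | refl = shared-endpoint⇒¬Crossing (endpoint (P i) oᵢ) (endpoint (P i) oⱼ)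

  edge-length-injective : ∀ {i j oᵢ oⱼ} → Nb i oᵢ → Nb j oⱼ → ∣ P i - oᵢ ∣ ≡ ∣ P j - oⱼ ∣ → i ≡ j × oᵢ ≡ oⱼ
  edge-length-injective {i} {j} nbᵢ nbⱼ eq with <-cmp (toℕ i) (toℕ j)
  ... | tri< i<j _ _ = ⊥-elim (<-irrefl (sym eq) (later-shorter i<j nbᵢ nbⱼ))
  ... | tri> _ _ j<i = ⊥-elim (<-irrefl eq (later-shorter j<i nbⱼ nbᵢ))
  ... | tri≈ _ i≡j _ with toℕ-injective i≡j
  ...   | refl = refl , neighbour-distance-injective (st-Fits i) nbᵢ nbⱼ eq

  module Placement (f : Fin n → ℕ) (rosaFrom : RosaFrom n E m bb f) where

    f-spine : ∀ k → f (bb k) ≡ P k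
    f-spine k = trans (proj₁ (rosaFrom k)) (cong proj₁ (rosa≡stateAt 0 (n ∸ 1) left m L k))

    f-leaf : ∀ {k u} → Leaf E u → Adj E u (bb k) → InBlock (st k) (L k) (f u)
    f-leaf {k} {u} u-leaf a = subst (λ r → proj₁ (proj₂ r) ≤ f u × f u < proj₁ (proj₂ r) + proj₂ (proj₂ r))
                                    (rosa≡stateAt 0 (n ∸ 1) left m L k) (proj₂ (rosaFrom k) u u-leaf a)

    f-charged : ∀ {k w} → Charged k w → Nb k (f w)
    f-charged (leaf w-leaf a) = inj₁ (f-leaf w-leaf a)
    f-charged {k} (spine i k≡1+i refl) = inj₂ (begin
      f (bb i)               ≡⟨ f-spine i ⟩
      P i                    ≡⟨ sym (prevPos-next (st-Fits i)) ⟩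
      prevPos (next (st i) (L i)) ≡⟨ cong prevPos (sym (stateAt-next start m L i k k≡1+i)) ⟩
      prevPos (st k)         ∎)
      where open ≡-Reasoning

    interval-charged : ∀ {e k w} → UnorderedEdge e (bb k) w → interval f e ≡ (P k ⊓ f w , P k ⊔ f w)
    interval-charged {k = k} (inj₁ refl) rewrite f-spine k = refl
    interval-charged {k = k} {w} (inj₂ refl) rewrite f-spine k = cong₂ _,_ (⊓-comm (f w) (P k)) (⊔-comm (f w) (P k))

    length-charged : ∀ {e k w} → UnorderedEdge e (bb k) w → ∣ f (proj₁ e) - f (proj₂ e) ∣ ≡ ∣ P k - f w ∣
    length-charged {k = k} (inj₁ refl) rewrite f-spine k = refl
    length-charged {k = k} {w} (inj₂ refl) rewrite f-spine k = ∣-∣-comm (f w) (P k)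

    planar : PlanarAt E f
    planar e∈ g∈ with classify e∈ | classify g∈
    ... | i , wᵢ , chᵢ , eᵢ | j , wⱼ , chⱼ , eⱼ =
      edges-non-crossing (f-charged chᵢ) (f-charged chⱼ) ∘ subst₂ Crossing (interval-charged eᵢ) (interval-charged eⱼ)

    module _ (f-injective : ∀ {u v} → f u ≡ f v → u ≡ v) where

      edgeLength : Edge n → ℕ
      edgeLength e = ∣ f (proj₁ e) - f (proj₂ e) ∣

      edgeLength-injective : ∀ {e g} → e ∈ E → g ∈ E → edgeLength e ≡ edgeLength g → SameEdge e g
      edgeLength-injective e∈ g∈ eq with classify e∈ | classify g∈
      ... | i , wᵢ , chᵢ , eᵢ | j , wⱼ , chⱼ , eⱼ
        with edge-length-injective (f-charged chᵢ) (f-charged chⱼ)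
               (trans (sym (length-charged eᵢ)) (trans eq (length-charged eⱼ)))
      ...   | refl , fw≡fw with f-injective fw≡fw
      ...     | refl = same eᵢ eⱼ
        where
        same : ∀ {e g u v} → UnorderedEdge e u v → UnorderedEdge g u v → SameEdge e g
        same (inj₁ refl) (inj₁ refl) = inj₁ (refl , refl)
        same (inj₁ refl) (inj₂ refl) = inj₂ (refl , refl)
        same (inj₂ refl) (inj₁ refl) = inj₂ (refl , refl)
        same (inj₂ refl) (inj₂ refl) = inj₁ (refl , refl)

      cost≥ : n C 2 ≤ costAt E f
      cost≥ = subst (λ k → k C 2 ≤ costAt E f) |E|+1≡n (distinct-positive-sum≥ (map edgeLength E) lengths! lengths≥1)
        where
        simple = proj₁ tree
        |E|+1≡n : suc (length (map edgeLength E)) ≡ n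
        |E|+1≡n = trans (cong suc (trans (length-map edgeLength E) (proj₂ (proj₂ tree)))) 1+[n∸1]≡n
        lengths! : Unique (map edgeLength E)
        lengths! = AllPairs.map⁺ (AllPairs-map∈ (proj₂ simple) λ e∈ g∈ ¬same eq → ¬same (edgeLength-injective e∈ g∈ eq))
        lengths≥1 : All (1 ≤_) (map edgeLength E)
        lengths≥1 = All.map⁺ (All.tabulate λ {e} e∈ → n≢0⇒n>0 λ len≡0 → proj₁ simple e e∈ (f-injective (∣m-n∣≡0⇒m≡n len≡0)))

  filled-disjoint : ∀ {i j p q} → toℕ i < toℕ j → FilledAt (st i) (L i) p → FilledAt (st j) (L j) q → p ≢ q
  filled-disjoint {i} {j} i<j (_ , p∉next) ((lo≤q , q≤hi) , _) refl
    with stateAt-Shrinks-next start m L start-Valid i j i<j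
  ... | _ , _ , lo≤ , hi≤ with p∉next
  ...   | inj₁ p<lo = <-irrefl refl (<-≤-trans p<lo (≤-trans lo≤ lo≤q))
  ...   | inj₂ hi<p = <-irrefl refl (≤-<-trans (≤-trans q≤hi hi≤) hi<p)

  rank : Fin (suc m) → Fin n → ℕ
  rank k v = length (filter (F._<? v) (leavesOf E (bb k)))

  rank<L : ∀ {k u} → u ∈ leavesOf E (bb k) → rank k u < L k
  rank<L {k} {u} u∈ = filter-notAll (F._<? u) (leavesOf E (bb k)) (lose u∈ (F.<-irrefl refl))

  rank-mono-< : ∀ {k u v} → u ∈ leavesOf E (bb k) → u F.< v → rank k u < rank k v
  rank-mono-< {k} {u} {v} u∈ u<v = Unique-⊆⇒length≤ _F≟_ (below-u≢u ∷ Unique.filter⁺ (F._<? u) (leavesOf-unique k)) ⊆below-v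
    where
    leavesOf-unique : ∀ k → Unique (leavesOf E (bb k))
    leavesOf-unique k = Unique.filter⁺ _ (Unique.allFin⁺ n)
    below-u≢u : All (u ≢_) (filter (F._<? u) (leavesOf E (bb k)))
    below-u≢u = All.tabulate λ y∈ u≡y → F.<-irrefl (sym u≡y) (proj₂ (∈-filter⁻ (F._<? u) {xs = leavesOf E (bb k)} y∈))
    ⊆below-v : u ∷ filter (F._<? u) (leavesOf E (bb k)) ⊆ filter (F._<? v) (leavesOf E (bb k))
    ⊆below-v (here refl) = ∈-filter⁺ (F._<? v) u∈ u<v
    ⊆below-v (there y∈) = let y∈′ , y<u = ∈-filter⁻ (F._<? u) {xs = leavesOf E (bb k)} y∈
                          in ∈-filter⁺ (F._<? v) y∈′ (F.<-trans y<u u<v)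

  rank-injective : ∀ {k u v} → u ∈ leavesOf E (bb k) → v ∈ leavesOf E (bb k) → rank k u ≡ rank k v → u ≡ v
  rank-injective {k} {u} {v} u∈ v∈ eq with F.<-cmp u v
  ... | tri< u<v _ _ = ⊥-elim (<-irrefl eq (rank-mono-< u∈ u<v))
  ... | tri≈ _ u≡v _ = u≡v
  ... | tri> _ _ v<u = ⊥-elim (<-irrefl (sym eq) (rank-mono-< v∈ v<u))

  place : Fin n → ℕ
  place v with Leaf? E v
  ... | yes v-leaf = let k , _ = leaf-attached v-leaf in blockStartOf (st k) (L k) + rank k v
  ... | no  v-spine = P (proj₁ (not-leaf⇒bb v v-spine))

  place-spine : ∀ k → place (bb k) ≡ P k
  place-spine k with Leaf? E (bb k)
  ... | yes bb-leaf = ⊥-elim (bb-not-leaf k bb-leaf)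
  ... | no  bb-spine with not-leaf⇒bb (bb k) bb-spine
  ...   | k′ , bb≡bb rewrite bb-injective bb≡bb = refl

  place-leaf : ∀ {k u} → Leaf E u → Adj E u (bb k) → place u ≡ blockStartOf (st k) (L k) + rank k u
  place-leaf {k} {u} u-leaf a with Leaf? E u
  ... | no  u-spine = ⊥-elim (u-spine u-leaf)
  ... | yes u-leaf′ with leaf-attached u-leaf′
  ...   | k′ , a′ rewrite leaf-attached-unique u-leaf′ a′ a = refl

  place-InBlock : ∀ {k u} → Leaf E u → Adj E u (bb k) → InBlock (st k) (L k) (place u)
  place-InBlock {k} u-leaf a rewrite place-leaf u-leaf a =
    m≤m+n _ _ , +-monoʳ-< (blockStartOf (st k) (L k)) (rank<L (leaf∈leavesOf u-leaf a))

  place-leaf≢spine : ∀ {k w} → Leaf E w → Adj E w (bb k) → place w ≢ place (bb k)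
  place-leaf≢spine {k} w-leaf a eq = proj₂ (block-FilledAt (st-Fits k) (place-InBlock w-leaf a)) (trans eq (place-spine k))

  Location : Fin n → Set
  Location v = ∃ λ k → FilledAt (st k) (L k) (place v) × (bb k ≡ v ⊎ Leaf E v × Adj E v (bb k))

  locate : ∀ v → Location v
  locate v = by-kind (Leaf? E v)
    where
    by-kind : Dec (Leaf E v) → Location v
    by-kind (no v-spine) = let k , bb≡v = not-leaf⇒bb v v-spine in
      k , subst (λ u → FilledAt (st k) (L k) (place u)) bb≡v (subst (FilledAt (st k) (L k)) (sym (place-spine k)) (spine-FilledAt (st-Fits k))) , inj₁ bb≡v
    by-kind (yes v-leaf) = let k , a = leaf-attached v-leaf in
      k , proj₁ (block-FilledAt (st-Fits k) (place-InBlock v-leaf a)) , inj₂ (v-leaf , a)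

  place-injective : ∀ {u v} → place u ≡ place v → u ≡ v
  place-injective {u} {v} eq with locate u | locate v
  ... | i , filledᵢ , whatᵢ | j , filledⱼ , whatⱼ with <-cmp (toℕ i) (toℕ j)
  ...   | tri< i<j _ _ = ⊥-elim (filled-disjoint i<j filledᵢ filledⱼ eq)
  ...   | tri> _ _ j<i = ⊥-elim (filled-disjoint j<i filledⱼ filledᵢ (sym eq))
  ...   | tri≈ _ i≡j _ with toℕ-injective i≡j | whatᵢ | whatⱼ
  ...     | refl | inj₁ refl | inj₁ refl = refl
  ...     | refl | inj₁ refl | inj₂ (v-leaf , a) = ⊥-elim (place-leaf≢spine v-leaf a (sym eq))
  ...     | refl | inj₂ (u-leaf , a) | inj₁ refl = ⊥-elim (place-leaf≢spine u-leaf a eq)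
  ...     | refl | inj₂ (u-leaf , a) | inj₂ (v-leaf , b) =
    rank-injective (leaf∈leavesOf u-leaf a) (leaf∈leavesOf v-leaf b)
      (+-cancelˡ-≡ (blockStartOf (st i) (L i)) _ _ (trans (sym (place-leaf u-leaf a)) (trans eq (place-leaf v-leaf b))))

  place<n : ∀ v → place v < n
  place<n v with locate v
  ... | k , ((_ , p≤hi) , _) , _ =
    subst (place v <_) 1+[n∸1]≡n (s≤s (≤-trans p≤hi (proj₂ (proj₂ (proj₂ (stateAt-Shrinks start m L start-Valid k))))))

  place-RosaFrom : RosaFrom n E m bb place
  place-RosaFrom k =
    subst (λ r → place (bb k) ≡ proj₁ r × (∀ u → Leaf E u → Adj E u (bb k) →
                   proj₁ (proj₂ r) ≤ place u × place u < proj₁ (proj₂ r) + proj₂ (proj₂ r)))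
          (sym (rosa≡stateAt 0 (n ∸ 1) left m L k))
          (place-spine k , λ u u-leaf a → place-InBlock u-leaf a)

  rosa-exists : ∃ λ π → RosaFrom n E m bb (pos π)
  rosa-exists = let π , pos≡ = arrangementFrom place place<n place-injective in
    π , λ k → trans (pos≡ (bb k)) (proj₁ (place-RosaFrom k)) ,
              λ u u-leaf a → subst (λ p → _ ≤ p × p < _) (sym (pos≡ u)) (proj₂ (place-RosaFrom k) u u-leaf a)

  pos≤n∸1 : ∀ (π : Arrangement n) v → pos π v ≤ n ∸ 1
  pos≤n∸1 π v = ≤-pred (subst (pos π v <_) (sym 1+[n∸1]≡n) (pos<n π v))

  rosa-planar-cost : ∀ π → IsRosa n E m bb π → Planar E π × cost E π ≡ n C 2
  rosa-planar-cost π (inj₁ rosaFrom) =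
    PlanarAt⇒Planar π planar , ≤-antisym (planar-cost≤ E π tree (PlanarAt⇒Planar π planar)) (cost≥ (pos-injective π))
    where open Placement (pos π) rosaFrom
  rosa-planar-cost π (inj₂ rosaFrom) =
    PlanarAt⇒Planar π planar′ ,
    ≤-antisym (planar-cost≤ E π tree (PlanarAt⇒Planar π planar′))
              (subst (n C 2 ≤_) (costAt-mirror (pos≤n∸1 π) E) (cost≥ (mirror-injective (pos≤n∸1 π) (pos-injective π))))
    where
    open Placement (λ v → n ∸ 1 ∸ pos π v) rosaFrom
    planar′ : PlanarAt E (pos π)
    planar′ = PlanarAt-mirror (pos≤n∸1 π) planar

  π₀ : Arrangement n
  π₀ = proj₁ rosa-exists

  π₀-planar-cost : Planar E π₀ × cost E π₀ ≡ n C 2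
  π₀-planar-cost = rosa-planar-cost π₀ (inj₁ (proj₂ rosa-exists))

  IsDplMax-C2 : IsDplMax n E (n C 2)
  IsDplMax-C2 = (π₀ , π₀-planar-cost) , λ σ → planar-cost≤ E σ tree

  -- π₀ puts bb zero at position 0, so no edge can cover it
  InVStar-first : InVStar n E (bb zero)
  InVStar-first = n C 2 , IsDplMax-C2 , (π₀ , (proj₁ π₀-planar-cost , uncovered) , proj₂ π₀-planar-cost) ,
                  λ σ projective → planar-cost≤ E σ tree (proj₁ projective)
    where
    uncovered : ∀ e → e ∈ E → ¬ (lpos π₀ e < pos π₀ (bb zero) × pos π₀ (bb zero) < rpos π₀ e)
    uncovered e _ (l<p , _) = n≮0 (subst (lpos π₀ e <_) (proj₁ (proj₂ rosa-exists zero)) l<p)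

caterpillar-Dpl≥ : ∀ {n} (E : EdgeList n) {d} → 3 ≤ n → IsCaterpillar n E → IsDplMax n E d → n C 2 ≤ d
caterpillar-Dpl≥ E 3≤n (tree , m , bb , backbone) (_ , d-max) =
  subst (_≤ _) (proj₂ π₀-planar-cost) (d-max π₀ (proj₁ π₀-planar-cost))
  where open RosaLayout E tree 3≤n m bb backbone

corollary5 : (n : ℕ) (E : EdgeList n) → 3 ≤ n → IsTree n E →
    (m : ℕ) (bb : Fin (suc m) → Fin n) → IsBackbone n E m bb →
    (π : Arrangement n) → IsRosa n E m bb π →
      (Planar E π × (∀ σ → Planar E σ → cost E σ ≤ cost E π))
      × IsDplMax n E (n C 2)
      × (∀ (E₁ E′ : EdgeList n) (d₁ d′ : ℕ) → IsCaterpillar n E₁ → IsTree n E′ →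
           IsDplMax n E₁ d₁ → IsDplMax n E′ d′ → d′ ≤ d₁)
      × (InVStar n E (bb zero) × InVStar n E (bb (fromℕ m)))
corollary5 n E 3≤n tree m bb backbone π rosa =
  (π-planar , λ σ σ-planar → subst (cost E σ ≤_) (sym π-cost) (planar-cost≤ E σ tree σ-planar)) ,
  IsDplMax-C2 ,
  (λ E₁ E′ d₁ d′ caterpillar tree′ D₁ ((σ , σ-planar , σ-cost) , _) →
     ≤-trans (subst (_≤ n C 2) σ-cost (planar-cost≤ E′ σ tree′ σ-planar)) (caterpillar-Dpl≥ E₁ 3≤n caterpillar D₁)) ,
  InVStar-first ,
  subst (InVStar n E ∘ bb) opposite-zero (RosaLayout.InVStar-first E tree 3≤n m (bb ∘ F.opposite) (IsBackbone-reverse backbone))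
  where
  open RosaLayout E tree 3≤n m bb backbone
  π-planar = proj₁ (rosa-planar-cost π rosa)
  π-cost = proj₂ (rosa-planar-cost π rosa)
  opposite-zero : F.opposite {suc m} zero ≡ fromℕ m
  opposite-zero = toℕ-injective (trans (F.opposite-prop {suc m} zero) (sym (F.toℕ-fromℕ m)))
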